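{- Let $G$ be a graph of genus $g$ (possibly with loops) and $D\in\operatorname{Div}(G)$. Then: (1) (Riemann–Roch) $r^{\#}_G(D)-r^{\#}_G(K^{\#}_G-D)=\deg D-g+1$. In particular $r^{\#}_G(K^{\#}_G)=g-1$ and $\deg K^{\#}_G=2g-2$. (2) (Riemann) If $\deg D\ge 2g-1$ then $r^{\#}_G(D)=\deg D-g$.
   Context: Graphs are finite and connected, loops and multiple edges allowed; the genus of $G$ is $|E(G)|-|V(G)|+1$. $\operatorname{Div}(G)$ is the free abelian group on $V(G)$. For $v\ne w$, $(v\cdot w)$ is the number of edges joining them; $(v\cdot v)=-\operatorname{val}(v)+2\operatorname{loop}(v)$ (valency with loops counted twice, $\operatorname{loop}(v)$ the number of loops at $v$). $T_v=\sum_w(v\cdot w)w$, $\operatorname{Prin}(G)$ generated by the $T_v$, $D\sim D'$ iff $D-D'\in\operatorname{Prin}(G)$, $|D|$ the set of effective divisors equivalent to $D$. The rank $r_G(D)$ is $-1$ if $|D|=\emptyset$, otherwise the maximum $k\ge0$ such that $|D-E|\ne\emptyset$ for every effective $E$ of degree $k$. $\widehat G$ is obtained from $G$ by inserting one new vertex in the interior of each loop-edge; $\sigma^*:\operatorname{Div}(G)\to\operatorname{Div}(\widehat G)$ is extension by zero; $r^{\#}_G(D):=r_{\widehat G}(\sigma^*D)$. The canonical divisor is $K^{\#}_G=\sum_{v\in V(G)}(\operatorname{val}(v)-2)v$. -}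

module Defs where

open import Data.Nat using (ℕ; zero; suc)
open import Data.Integer using (ℤ; +_; -_; _+_; _-_; _*_; _≤_)
open import Data.Fin using (Fin; zero; suc; _↑ˡ_; _↑ʳ_; splitAt; _≟_)
open import Data.Fin.Properties using ()
open import Data.List using (List; []; _∷_; length; map; _++_; concat; lookup; allFin)
open import Data.List.Relation.Unary.All using (All)
open import Data.List.Membership.Propositional using (_∈_)
open import Data.Product using (_×_; _,_; proj₁; proj₂; Σ; ∃)
open import Data.Sum using (_⊎_; inj₁; inj₂; [_,_])
open import Relation.Nullary using (¬_; does)
open import Relation.Binary.PropositionalEquality using (_≡_; _≢_)
open import Data.Bool using (Bool; true; false; if_then_else_)

-- Vertices are Fin n.  'edges' lists the non-loop edges (each an
-- unordered pair, stored as an ordered pair; multiplicities = repetitions);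
-- 'loops' lists the loop edges, each given by the vertex it is attached to.

record Graph : Set where
  constructor graph
  field
    n     : ℕ
    edges : List (Fin n × Fin n)
    loops : List (Fin n)
open Graph public

NonLoopEdges : Graph → Set
NonLoopEdges G = All (λ e → proj₁ e ≢ proj₂ e) (edges G)

data Reach (G : Graph) : Fin (n G) → Fin (n G) → Set where
  here  : ∀ {v} → Reach G v v
  stepF : ∀ {u v w} → (v , w) ∈ edges G →
          Reach G w u → Reach G v u
  stepB : ∀ {u v w} → (w , v) ∈ edges G →
          Reach G w u → Reach G v u

Connected : Graph → Set
Connected G = ∀ v w → Reach G v w

b2z : Bool → ℤ
b2z true  = + 1
b2z false = + 0

ends : ∀ {n} → Fin n → Fin n × Fin n → ℤ
ends v (a , b) = b2z (does (v ≟ a)) + b2z (does (v ≟ b))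

sumL : List ℤ → ℤ
sumL []       = + 0
sumL (x ∷ xs) = x + sumL xs

loop : (G : Graph) → Fin (n G) → ℤ
loop G v = sumL (map (λ u → b2z (does (v ≟ u))) (loops G))

val : (G : Graph) → Fin (n G) → ℤ
val G v = sumL (map (ends v) (edges G)) + (+ 2) * loop G v

joining : (G : Graph) → Fin (n G) → Fin (n G) → ℤ
joining G v w = sumL (map (λ e → b2z (does (v ≟ proj₁ e)) * b2z (does (w ≟ proj₂ e))
                              + b2z (does (w ≟ proj₁ e)) * b2z (does (v ≟ proj₂ e)))
                          (edges G))

dot : (G : Graph) → Fin (n G) → Fin (n G) → ℤ
dot G v w = if does (v ≟ w) then - val G v + (+ 2) * loop G v else joining G v w

genus : Graph → ℤ
genus G = (+ length (edges G) + + length (loops G)) - + n G + + 1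

Div : ℕ → Set
Div k = Fin k → ℤ

∑ : ∀ {k} → (Fin k → ℤ) → ℤ
∑ {zero}  f = + 0
∑ {suc k} f = f zero + ∑ (λ i → f (suc i))

deg : ∀ {k} → Div k → ℤ
deg = ∑

_⊝_ : ∀ {k} → Div k → Div k → Div k
(D ⊝ E) v = D v - E v

Effective : ∀ {k} → Div k → Set
Effective D = ∀ v → + 0 ≤ D v

-- T_v = Σ_w (v·w) w ; D principal iff D = Σ_v c_v T_v for some c
Principal : (G : Graph) → Div (n G) → Set
Principal G D = Σ (Div (n G)) λ c → ∀ w → D w ≡ ∑ (λ v → c v * dot G v w)

LinEquiv : (G : Graph) → Div (n G) → Div (n G) → Set
LinEquiv G D D' = Principal G (D ⊝ D')

LinSysNonempty : (G : Graph) → Div (n G) → Set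
LinSysNonempty G D = Σ (Div (n G)) λ E → Effective E × LinEquiv G E D

Good : (G : Graph) → Div (n G) → ℕ → Set
Good G D k = ∀ E → Effective E → deg E ≡ + k → LinSysNonempty G (D ⊝ E)

IsRank : (G : Graph) → Div (n G) → ℤ → Set
IsRank G D r =
  (r ≡ - (+ 1) × ¬ LinSysNonempty G D)
  ⊎ Σ ℕ λ k → r ≡ + k × LinSysNonempty G D × Good G D k
               × (∀ m → Good G D m → m Data.Nat.≤ k)

-- The graph Ĝ: a new vertex inserted in the interior of each loop.
-- The i-th loop (at vertex v) becomes two parallel edges v — (n + i).

hat : Graph → Graph
hat (graph k es ls) =
  graph (k Data.Nat.+ L)
        (map (λ e → (proj₁ e ↑ˡ L , proj₂ e ↑ˡ L)) es
          ++ concat (map (λ i → (lookup ls i ↑ˡ L , k ↑ʳ i) ∷ (lookup ls i ↑ˡ L , k ↑ʳ i) ∷ [])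
                         (allFin L)))
        []
  where
  L = length ls

σ* : (G : Graph) → Div (n G) → Div (n (hat G))
σ* (graph k es ls) D x = [ D , (λ _ → + 0) ] (splitAt k x)

IsRank# : (G : Graph) → Div (n G) → ℤ → Set
IsRank# G D r = IsRank (hat G) (σ* G D) r

K# : (G : Graph) → Div (n G)
K# G v = val G v - + 2

module Submission where

-- Subdividing every loop turns G into a loopless graph Ĝ; σ* identifies
-- divisors of G with divisors of Ĝ supported on the old vertices, preserves
-- degrees, sends K#_G to the canonical divisor K_Ĝ, and g(Ĝ) = g(G).  So the
-- theorem is Riemann–Roch for the connected loopless graph Ĝ, proved by
-- Baker–Norine's argument:
--   * principal divisors are images of the Laplacian, so linear equivalence
--     is an equivalence relation preserving degree;
--   * an acyclic orientation, presented by an edge-injective ranking ρ of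
--     the vertices, gives ν_ρ = indeg_ρ − 1 with (N1) |ν_ρ| = ∅,
--     (N3) K − ν_ρ = ν_{−ρ}, and deg ν_ρ = g − 1;
--   * (N2) via Dhar's burning algorithm, every divisor is equivalent to an
--     effective divisor or to ν_ρ − F with F effective;
--   * hence r(D) + 1 = min { deg⁺(D' − ν) : D' ∼ D, ν = ν_ρ }, and the
--     involution (D', ν) ↦ (K − D', K − ν) gives the Riemann–Roch formula.

open import Defs
open import Data.Nat as ℕ using (ℕ; zero; suc)
import Data.Nat.Properties as ℕP
open import Data.Integer as ℤ using (ℤ; +_; -[1+_]; _+_; _-_; _*_; -_; _≤_; _<_)
import Data.Integer.Properties as ℤP
open import Data.Integer.Tactic.RingSolver using (solve-∀)
import Data.Nat.Tactic.RingSolver as ℕSolver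
open import Data.Fin as F using (Fin; zero; suc; _≟_; _↑ˡ_; _↑ʳ_; splitAt)
import Data.Fin.Properties as FP
open import Data.List using (List; []; _∷_; map; length; _++_; concat; tabulate; lookup; allFin)
import Data.List.Properties as LP
open import Data.List.Relation.Unary.All using (All; []; _∷_) renaming (map to All-map)
import Data.List.Relation.Unary.All.Properties as AllP
open import Data.List.Relation.Unary.Any using (here; there)
open import Data.List.Membership.Propositional using (_∈_)
open import Data.List.Membership.Propositional.Properties using (∈-map⁺; ∈-++⁺ˡ; ∈-++⁺ʳ; ∈-concat⁺′; ∈-allFin)
open import Data.Product using (Σ; _×_; _,_; proj₁; proj₂)
open import Data.Sum using (_⊎_; inj₁; inj₂)
open import Data.Empty using (⊥; ⊥-elim)
open import Relation.Nullary using (¬_; Dec; yes; no; does)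
open import Relation.Nullary.Decidable using (_×-dec_; decidable-stable)
open import Relation.Nullary.Negation using (¬¬-map)
open import Relation.Binary.Definitions using (tri<; tri≈; tri>)
open import Relation.Binary.PropositionalEquality

≤-cast : ∀ {a b c d : ℤ} → a ≤ b → a ≡ c → b ≡ d → c ≤ d
≤-cast p refl refl = p

0≤* : ∀ {a b : ℤ} → + 0 ≤ a → + 0 ≤ b → + 0 ≤ a * b
0≤* {+ a} {+ b} (ℤ.+≤+ _) (ℤ.+≤+ _) = ≤-cast {b = + (a ℕ.* b)} (ℤ.+≤+ ℕ.z≤n) refl (ℤP.pos-* a b)

<⇒+1≤ : ∀ {x y : ℤ} → x < y → x + + 1 ≤ y
<⇒+1≤ {x} p = ≤-cast (ℤP.i<j⇒suc[i]≤j p) (ℤP.+-comm (+ 1) x) refl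

+1≤⇒< : ∀ {x y : ℤ} → x + + 1 ≤ y → x < y
+1≤⇒< {x} p = ℤP.suc[i]≤j⇒i<j (≤-cast p (ℤP.+-comm x (+ 1)) refl)

does-≡ : ∀ {P Q : Set} (d : Dec P) (e : Dec Q) → (P → Q) → (Q → P) → does d ≡ does e
does-≡ (yes p) (yes q) f g = refl
does-≡ (no ¬p) (no ¬q) f g = refl
does-≡ (yes p) (no ¬q) f g = ⊥-elim (¬q (f p))
does-≡ (no ¬p) (yes q) f g = ⊥-elim (¬p (g q))

𝟙 : ∀ {P : Set} → Dec P → ℤ
𝟙 (yes _) = + 1
𝟙 (no _) = + 0

𝟙-nonneg : ∀ {P : Set} (d : Dec P) → + 0 ≤ 𝟙 d
𝟙-nonneg (yes _) = ℤ.+≤+ ℕ.z≤n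
𝟙-nonneg (no _) = ℤ.+≤+ ℕ.z≤n

𝟙-yes : ∀ {P : Set} (d : Dec P) → P → 𝟙 d ≡ + 1
𝟙-yes (yes _) p = refl
𝟙-yes (no ¬p) p = ⊥-elim (¬p p)

𝟙-no : ∀ {P : Set} (d : Dec P) → ¬ P → 𝟙 d ≡ + 0
𝟙-no (yes p) ¬p = ⊥-elim (¬p p)
𝟙-no (no _) ¬p = refl

δ : ∀ {m} → Fin m → Fin m → ℤ
δ v w = b2z (does (v ≟ w))

δ-nonneg : ∀ {m} (v w : Fin m) → + 0 ≤ δ v w
δ-nonneg v w with v ≟ w
... | yes _ = ℤ.+≤+ ℕ.z≤n
... | no _ = ℤ.+≤+ ℕ.z≤n

δ-≢ : ∀ {m} {v w : Fin m} → v ≢ w → δ v w ≡ + 0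
δ-≢ {v = v} {w} ne with v ≟ w
... | yes p = ⊥-elim (ne p)
... | no _ = refl

δ-sym : ∀ {m} (v w : Fin m) → δ v w ≡ δ w v
δ-sym v w = cong b2z (does-≡ (v ≟ w) (w ≟ v) sym sym)

δ-subst : ∀ {m} (v w : Fin m) (f : Fin m → ℤ) → δ v w * f v ≡ δ v w * f w
δ-subst v w f with v ≟ w
... | yes refl = refl
... | no _ = refl

∑-cong : ∀ {k} {f g : Fin k → ℤ} → (∀ i → f i ≡ g i) → ∑ f ≡ ∑ g
∑-cong {zero} eq = refl
∑-cong {suc k} eq = cong₂ _+_ (eq zero) (∑-cong (λ i → eq (suc i)))

private
  +-interchange : ∀ a b c d → (a + b) + (c + d) ≡ (a + c) + (b + d)
  +-interchange = solve-∀

∑-+ : ∀ {k} (f g : Fin k → ℤ) → ∑ (λ i → f i + g i) ≡ ∑ f + ∑ g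
∑-+ {zero} f g = refl
∑-+ {suc k} f g = trans (cong (λ z → (f zero + g zero) + z) (∑-+ (λ i → f (suc i)) (λ i → g (suc i))))
                        (+-interchange (f zero) (g zero) _ _)

∑-0 : ∀ {k} → ∑ {k} (λ _ → + 0) ≡ + 0
∑-0 {zero} = refl
∑-0 {suc k} = cong (λ z → + 0 + z) (∑-0 {k})

∑-* : ∀ {k} (x : ℤ) (f : Fin k → ℤ) → ∑ (λ i → x * f i) ≡ x * ∑ f
∑-* {zero} x f = sym (ℤP.*-zeroʳ x)
∑-* {suc k} x f = trans (cong (λ z → x * f zero + z) (∑-* x (λ i → f (suc i))))
                        (sym (ℤP.*-distribˡ-+ x (f zero) _))

∑-neg : ∀ {k} (f : Fin k → ℤ) → ∑ (λ i → - f i) ≡ - ∑ f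
∑-neg {zero} f = refl
∑-neg {suc k} f = trans (cong (λ z → - f zero + z) (∑-neg (λ i → f (suc i))))
                        (sym (ℤP.neg-distrib-+ (f zero) _))

∑-- : ∀ {k} (f g : Fin k → ℤ) → ∑ (λ i → f i - g i) ≡ ∑ f - ∑ g
∑-- f g = trans (∑-+ f (λ i → - g i)) (cong (λ z → ∑ f + z) (∑-neg g))

∑-const : ∀ {k} (x : ℤ) → ∑ {k} (λ _ → x) ≡ + k * x
∑-const {zero} x = sym (ℤP.*-zeroˡ x)
∑-const {suc k} x = trans (cong (λ z → x + z) (∑-const {k} x))
                          (trans (cong (_+ + k * x) (sym (ℤP.*-identityˡ x)))
                                 (sym (ℤP.*-distribʳ-+ x (+ 1) (+ k))))

∑-δ : ∀ {k} (a : Fin k) (f : Fin k → ℤ) → ∑ (λ v → δ v a * f v) ≡ f a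
∑-δ {suc k} zero f =
  trans (cong₂ _+_ (ℤP.*-identityˡ (f zero))
          (trans (∑-cong (λ i → ℤP.*-zeroˡ (f (suc i)))) (∑-0 {k})))
        (ℤP.+-identityʳ (f zero))
∑-δ {suc k} (suc a) f =
  trans (cong₂ _+_ (ℤP.*-zeroˡ (f zero)) (∑-δ a (λ i → f (suc i))))
        (ℤP.+-identityˡ (f (suc a)))

∑-δ' : ∀ {k} (a : Fin k) (f : Fin k → ℤ) → ∑ (λ v → δ a v * f v) ≡ f a
∑-δ' a f = trans (∑-cong (λ v → cong (_* f v) (δ-sym a v))) (∑-δ a f)

∑δ : ∀ {k} (a : Fin k) → ∑ (λ v → δ v a) ≡ + 1
∑δ a = trans (∑-cong (λ v → sym (ℤP.*-identityʳ (δ v a)))) (∑-δ a (λ _ → + 1))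

∑δ' : ∀ {k} (a : Fin k) → ∑ (λ v → δ a v) ≡ + 1
∑δ' a = trans (∑-cong (λ v → sym (ℤP.*-identityʳ (δ a v)))) (∑-δ' a (λ _ → + 1))

∑-mono : ∀ {k} {f g : Fin k → ℤ} → (∀ i → f i ≤ g i) → ∑ f ≤ ∑ g
∑-mono {zero} p = ℤP.≤-refl
∑-mono {suc k} p = ℤP.+-mono-≤ (p zero) (∑-mono (λ i → p (suc i)))

∑-nonneg : ∀ {k} {f : Fin k → ℤ} → (∀ i → + 0 ≤ f i) → + 0 ≤ ∑ f
∑-nonneg {k} p = ≤-cast (∑-mono {k} {λ _ → + 0} p) (∑-0 {k}) refl

∑-single : ∀ {k} {f : Fin k → ℤ} → (∀ i → + 0 ≤ f i) → ∀ a → f a ≤ ∑ f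
∑-single {suc k} {f} p zero = ≤-cast (ℤP.+-mono-≤ (ℤP.≤-refl {f zero}) (∑-nonneg (λ i → p (suc i))))
                                     (ℤP.+-identityʳ (f zero)) refl
∑-single {suc k} {f} p (suc a) = ≤-cast (ℤP.+-mono-≤ (p zero) (∑-single (λ i → p (suc i)) a))
                                        (ℤP.+-identityˡ (f (suc a))) refl

∑-split : ∀ k L (f : Fin (k ℕ.+ L) → ℤ) → ∑ f ≡ ∑ (λ i → f (i ↑ˡ L)) + ∑ (λ j → f (k ↑ʳ j))
∑-split zero L f = sym (ℤP.+-identityˡ _)
∑-split (suc k) L f = trans (cong (λ z → f zero + z) (∑-split k L (λ i → f (suc i))))
                            (sym (ℤP.+-assoc (f zero) _ _))

∑ℕ : ∀ {k} → (Fin k → ℕ) → ℕ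
∑ℕ {zero} f = 0
∑ℕ {suc k} f = f zero ℕ.+ ∑ℕ (λ i → f (suc i))

∑ℕ-mono : ∀ {k} {f g : Fin k → ℕ} → (∀ i → f i ℕ.≤ g i) → ∑ℕ f ℕ.≤ ∑ℕ g
∑ℕ-mono {zero} p = ℕ.z≤n
∑ℕ-mono {suc k} p = ℕP.+-mono-≤ (p zero) (∑ℕ-mono (λ i → p (suc i)))

∑ℕ-strict : ∀ {k} {f g : Fin k → ℕ} → (∀ i → f i ℕ.≤ g i) → (a : Fin k) → f a ℕ.< g a → ∑ℕ f ℕ.< ∑ℕ g
∑ℕ-strict {suc k} p zero lt = ℕP.+-mono-<-≤ lt (∑ℕ-mono (λ i → p (suc i)))
∑ℕ-strict {suc k} p (suc a) lt = ℕP.+-mono-≤-< (p zero) (∑ℕ-strict (λ i → p (suc i)) a lt)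

∑ℕ-single : ∀ {k} (f : Fin k → ℕ) (a : Fin k) → f a ℕ.≤ ∑ℕ f
∑ℕ-single {suc k} f zero = ℕP.m≤m+n (f zero) _
∑ℕ-single {suc k} f (suc a) = ℕP.≤-trans (∑ℕ-single (λ i → f (suc i)) a) (ℕP.m≤n+m _ (f zero))

∑-pos : ∀ {k} (f : Fin k → ℕ) → ∑ (λ v → + f v) ≡ + ∑ℕ f
∑-pos {zero} f = refl
∑-pos {suc k} f = trans (cong (λ z → + f zero + z) (∑-pos (λ i → f (suc i)))) (sym (ℤP.pos-+ (f zero) _))

sumL-cong : ∀ {A : Set} {f g : A → ℤ} (xs : List A) →
            (∀ x → f x ≡ g x) → sumL (map f xs) ≡ sumL (map g xs)
sumL-cong [] h = refl
sumL-cong (x ∷ xs) h = cong₂ _+_ (h x) (sumL-cong xs h)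

sumL-congᴬ : ∀ {A : Set} {P : A → Set} {f g : A → ℤ} {xs : List A} →
             All P xs → (∀ {x} → P x → f x ≡ g x) → sumL (map f xs) ≡ sumL (map g xs)
sumL-congᴬ [] h = refl
sumL-congᴬ (p ∷ ps) h = cong₂ _+_ (h p) (sumL-congᴬ ps h)

sumL-+ : ∀ {A : Set} (f g : A → ℤ) (xs : List A) →
         sumL (map (λ x → f x + g x) xs) ≡ sumL (map f xs) + sumL (map g xs)
sumL-+ f g [] = refl
sumL-+ f g (x ∷ xs) = trans (cong (λ z → (f x + g x) + z) (sumL-+ f g xs)) (+-interchange (f x) (g x) _ _)

sumL-0 : ∀ {A : Set} (xs : List A) → sumL (map (λ _ → + 0) xs) ≡ + 0
sumL-0 [] = refl
sumL-0 (x ∷ xs) = cong (λ z → + 0 + z) (sumL-0 xs)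

sumL-neg : ∀ {A : Set} (f : A → ℤ) (xs : List A) →
           sumL (map (λ x → - f x) xs) ≡ - sumL (map f xs)
sumL-neg f [] = refl
sumL-neg f (x ∷ xs) = trans (cong (λ z → - f x + z) (sumL-neg f xs)) (sym (ℤP.neg-distrib-+ (f x) _))

sumL-- : ∀ {A : Set} (f g : A → ℤ) (xs : List A) →
         sumL (map (λ x → f x - g x) xs) ≡ sumL (map f xs) - sumL (map g xs)
sumL-- f g xs = trans (sumL-+ f (λ x → - g x) xs) (cong (λ z → sumL (map f xs) + z) (sumL-neg g xs))

sumL-* : ∀ {A : Set} (c : ℤ) (f : A → ℤ) (xs : List A) →
         sumL (map (λ x → c * f x) xs) ≡ c * sumL (map f xs)
sumL-* c f [] = sym (ℤP.*-zeroʳ c)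
sumL-* c f (x ∷ xs) = trans (cong (λ z → c * f x + z) (sumL-* c f xs)) (sym (ℤP.*-distribˡ-+ c (f x) _))

sumL-1 : ∀ {A : Set} (xs : List A) → sumL (map (λ _ → + 1) xs) ≡ + length xs
sumL-1 [] = refl
sumL-1 (x ∷ xs) = cong (λ z → + 1 + z) (sumL-1 xs)

sumL-mono : ∀ {A : Set} {f g : A → ℤ} (xs : List A) →
            (∀ x → f x ≤ g x) → sumL (map f xs) ≤ sumL (map g xs)
sumL-mono [] h = ℤP.≤-refl
sumL-mono (x ∷ xs) h = ℤP.+-mono-≤ (h x) (sumL-mono xs h)

sumL-monoᴬ : ∀ {A : Set} {P : A → Set} {f g : A → ℤ} {xs : List A} →
             All P xs → (∀ {x} → P x → f x ≤ g x) → sumL (map f xs) ≤ sumL (map g xs)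
sumL-monoᴬ [] h = ℤP.≤-refl
sumL-monoᴬ (p ∷ ps) h = ℤP.+-mono-≤ (h p) (sumL-monoᴬ ps h)

sumL-nonpos : ∀ {A : Set} {f : A → ℤ} (xs : List A) → (∀ x → f x ≤ + 0) → sumL (map f xs) ≤ + 0
sumL-nonpos {f = f} xs h = ≤-cast (sumL-mono {f = f} {g = λ _ → + 0} xs h) refl (sumL-0 xs)

sumL-nonneg : ∀ {A : Set} {f : A → ℤ} (xs : List A) → (∀ x → + 0 ≤ f x) → + 0 ≤ sumL (map f xs)
sumL-nonneg {f = f} xs h = ≤-cast (sumL-mono {f = λ _ → + 0} {g = f} xs h) (sumL-0 xs) refl

sumL-≤-member : ∀ {A : Set} {f : A → ℤ} {xs : List A} {y : A} → (∀ x → f x ≤ + 0) → y ∈ xs →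
                sumL (map f xs) ≤ f y
sumL-≤-member {f = f} {x ∷ xs} h (here refl) =
  ≤-cast (ℤP.+-mono-≤ (ℤP.≤-refl {f x}) (sumL-nonpos xs h)) refl (ℤP.+-identityʳ (f x))
sumL-≤-member {f = f} {x ∷ xs} {y} h (there m) =
  ≤-cast (ℤP.+-mono-≤ (h x) (sumL-≤-member h m)) refl (ℤP.+-identityˡ (f y))

sumL-++ : ∀ {A : Set} (f : A → ℤ) (xs ys : List A) →
          sumL (map f (xs ++ ys)) ≡ sumL (map f xs) + sumL (map f ys)
sumL-++ f [] ys = sym (ℤP.+-identityˡ _)
sumL-++ f (x ∷ xs) ys = trans (cong (λ z → f x + z) (sumL-++ f xs ys)) (sym (ℤP.+-assoc (f x) _ _))

sumL-map : ∀ {A B : Set} (f : B → ℤ) (g : A → B) (xs : List A) →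
           sumL (map f (map g xs)) ≡ sumL (map (λ x → f (g x)) xs)
sumL-map f g xs = cong sumL (sym (LP.map-∘ xs))

sumL-concat : ∀ {A : Set} (φ : A → ℤ) (xss : List (List A)) →
              sumL (map φ (concat xss)) ≡ sumL (map (λ xs → sumL (map φ xs)) xss)
sumL-concat φ [] = refl
sumL-concat φ (xs ∷ xss) = trans (sumL-++ φ xs (concat xss)) (cong (λ z → sumL (map φ xs) + z) (sumL-concat φ xss))

sumL-tabulate : ∀ {A : Set} {m} (g : Fin m → A) (f : A → ℤ) → sumL (map f (tabulate g)) ≡ ∑ (λ i → f (g i))
sumL-tabulate {m = zero} g f = refl
sumL-tabulate {m = suc m} g f = cong (λ z → f (g zero) + z) (sumL-tabulate (λ i → g (suc i)) f)

∑-sumL : ∀ {k} {A : Set} (xs : List A) (g : Fin k → A → ℤ) →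
         ∑ (λ v → sumL (map (g v) xs)) ≡ sumL (map (λ x → ∑ (λ v → g v x)) xs)
∑-sumL {k} [] g = ∑-0 {k}
∑-sumL (x ∷ xs) g = trans (∑-+ (λ v → g v x) (λ v → sumL (map (g v) xs)))
                          (cong (λ z → ∑ (λ v → g v x) + z) (∑-sumL xs g))

-- The principal divisor of a script c : V → ℤ is Σ_v c(v) T_v;
-- it equals Δc, where (Δc)(w) = Σ_{edges e ∋ w} (c(other end) − c(w)).

module Laplacian {N : ℕ} (es : List (Fin N × Fin N)) (loopless : All (λ e → proj₁ e ≢ proj₂ e) es) where

  H : Graph
  H = graph N es []

  nbrSum : Fin N → (Fin N → ℤ) → ℤ
  nbrSum w f = sumL (map (λ e → δ w (proj₁ e) * f (proj₂ e) + δ w (proj₂ e) * f (proj₁ e)) es)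

  edgeFlow : (Fin N → ℤ) → Fin N → Fin N × Fin N → ℤ
  edgeFlow c w e = δ w (proj₁ e) * (c (proj₂ e) - c (proj₁ e)) + δ w (proj₂ e) * (c (proj₁ e) - c (proj₂ e))

  Δ : (Fin N → ℤ) → Fin N → ℤ
  Δ c w = sumL (map (edgeFlow c w) es)

  edgeDot : Fin N → Fin N → Fin N × Fin N → ℤ
  edgeDot v w e = δ v (proj₁ e) * δ w (proj₂ e) + δ w (proj₁ e) * δ v (proj₂ e)
                  - δ v w * (δ w (proj₁ e) + δ w (proj₂ e))

  δ-ends : ∀ (v a b : Fin N) → a ≢ b → δ v a * δ v b ≡ + 0
  δ-ends v a b ne with v ≟ a | v ≟ b
  ... | yes refl | yes refl = ⊥-elim (ne refl)
  ... | yes _ | no _ = refl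
  ... | no _ | yes _ = refl
  ... | no _ | no _ = refl

  private
    self-dot : ∀ x → - (x + + 2 * + 0) + + 2 * + 0 ≡ - x
    self-dot = solve-∀
    zero-edge : ∀ q → + 0 + + 0 - + 1 * q ≡ - q
    zero-edge = solve-∀
    self-edge : ∀ p q → p ≡ + 0 → p + p - + 1 * q ≡ - q
    self-edge p q refl = zero-edge q
    other-edge : ∀ x → x - + 0 * x ≡ x
    other-edge = solve-∀

  dot-edges : ∀ v w → dot H v w ≡ sumL (map (edgeDot v w) es)
  dot-edges v w with v ≟ w
  ... | yes refl =
        trans (self-dot (sumL (map (ends v) es)))
          (trans (sym (sumL-neg (ends v) es))
            (sumL-congᴬ loopless λ {e} ne →
              sym (self-edge (δ v (proj₁ e) * δ v (proj₂ e)) (δ v (proj₁ e) + δ v (proj₂ e))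
                             (δ-ends v (proj₁ e) (proj₂ e) ne))))
  ... | no _ = sumL-cong es (λ e → sym (other-edge _))

  private
    expand-edgeDot : ∀ cv dva dwb dwa dvb dvw →
      cv * (dva * dwb + dwa * dvb - dvw * (dwa + dwb))
      ≡ (dwb * (dva * cv) + dwa * (dvb * cv)) - (dwa + dwb) * (dvw * cv)
    expand-edgeDot = solve-∀
    collect-flow : ∀ dwa dwb ca cb → (dwb * ca + dwa * cb) - (dwa * ca + dwb * cb)
                                   ≡ dwa * (cb - ca) + dwb * (ca - cb)
    collect-flow = solve-∀

  ∑-edgeDot : ∀ (c : Fin N → ℤ) w e → ∑ (λ v → c v * edgeDot v w e) ≡ edgeFlow c w e
  ∑-edgeDot c w (a , b) =
    begin
      ∑ (λ v → c v * edgeDot v w (a , b))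
    ≡⟨ ∑-cong (λ v → expand-edgeDot (c v) (δ v a) (δ w b) (δ w a) (δ v b) (δ v w)) ⟩
      ∑ (λ v → (δ w b * (δ v a * c v) + δ w a * (δ v b * c v)) - (δ w a + δ w b) * (δ v w * c v))
    ≡⟨ ∑-- (λ v → δ w b * (δ v a * c v) + δ w a * (δ v b * c v)) (λ v → (δ w a + δ w b) * (δ v w * c v)) ⟩
      ∑ (λ v → δ w b * (δ v a * c v) + δ w a * (δ v b * c v)) - ∑ (λ v → (δ w a + δ w b) * (δ v w * c v))
    ≡⟨ cong₂ _-_ (∑-+ (λ v → δ w b * (δ v a * c v)) (λ v → δ w a * (δ v b * c v)))
                 (∑-* (δ w a + δ w b) (λ v → δ v w * c v)) ⟩
      (∑ (λ v → δ w b * (δ v a * c v)) + ∑ (λ v → δ w a * (δ v b * c v))) - (δ w a + δ w b) * ∑ (λ v → δ v w * c v)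
    ≡⟨ cong₂ _-_ (cong₂ _+_ (∑-* (δ w b) (λ v → δ v a * c v)) (∑-* (δ w a) (λ v → δ v b * c v))) refl ⟩
      (δ w b * ∑ (λ v → δ v a * c v) + δ w a * ∑ (λ v → δ v b * c v)) - (δ w a + δ w b) * ∑ (λ v → δ v w * c v)
    ≡⟨ cong₂ _-_ (cong₂ _+_ (cong (δ w b *_) (∑-δ a c)) (cong (δ w a *_) (∑-δ b c)))
                 (cong ((δ w a + δ w b) *_) (∑-δ w c)) ⟩
      (δ w b * c a + δ w a * c b) - (δ w a + δ w b) * c w
    ≡⟨ cong (λ z → (δ w b * c a + δ w a * c b) - z)
         (trans (ℤP.*-distribʳ-+ (c w) (δ w a) (δ w b))
                (cong₂ _+_ (δ-subst w a c) (δ-subst w b c))) ⟩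
      (δ w b * c a + δ w a * c b) - (δ w a * c a + δ w b * c b)
    ≡⟨ collect-flow (δ w a) (δ w b) (c a) (c b) ⟩
      edgeFlow c w (a , b)
    ∎
    where open ≡-Reasoning

  principal-Δ : ∀ c w → ∑ (λ v → c v * dot H v w) ≡ Δ c w
  principal-Δ c w =
    begin
      ∑ (λ v → c v * dot H v w)
    ≡⟨ ∑-cong (λ v → trans (cong (c v *_) (dot-edges v w)) (sym (sumL-* (c v) (edgeDot v w) es))) ⟩
      ∑ (λ v → sumL (map (λ e → c v * edgeDot v w e) es))
    ≡⟨ ∑-sumL es (λ v e → c v * edgeDot v w e) ⟩
      sumL (map (λ e → ∑ (λ v → c v * edgeDot v w e)) es)
    ≡⟨ sumL-cong es (∑-edgeDot c w) ⟩
      Δ c w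
    ∎
    where open ≡-Reasoning

  private
    flow-+ : ∀ x y a b c d → x * ((c + d) - (a + b)) + y * ((a + b) - (c + d))
                           ≡ (x * (c - a) + y * (a - c)) + (x * (d - b) + y * (b - d))
    flow-+ = solve-∀
    flow-neg : ∀ x y a c → x * (- c - - a) + y * (- a - - c) ≡ - (x * (c - a) + y * (a - c))
    flow-neg = solve-∀
    flow-0 : ∀ x y → x * (+ 0 - + 0) + y * (+ 0 - + 0) ≡ + 0
    flow-0 = solve-∀
    flow-cancel : ∀ a b → (b - a) + (a - b) ≡ + 0
    flow-cancel = solve-∀

  Δ-+ : ∀ c d w → Δ (λ v → c v + d v) w ≡ Δ c w + Δ d w
  Δ-+ c d w = trans (sumL-cong es (λ e → flow-+ (δ w (proj₁ e)) (δ w (proj₂ e)) (c (proj₁ e)) (d (proj₁ e))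
                                                 (c (proj₂ e)) (d (proj₂ e))))
                    (sumL-+ (edgeFlow c w) (edgeFlow d w) es)

  Δ-neg : ∀ c w → Δ (λ v → - c v) w ≡ - Δ c w
  Δ-neg c w = trans (sumL-cong es (λ e → flow-neg (δ w (proj₁ e)) (δ w (proj₂ e)) (c (proj₁ e)) (c (proj₂ e))))
                    (sumL-neg (edgeFlow c w) es)

  Δ-0 : ∀ w → Δ (λ _ → + 0) w ≡ + 0
  Δ-0 w = trans (sumL-cong es (λ e → flow-0 (δ w (proj₁ e)) (δ w (proj₂ e)))) (sumL-0 es)

  ∑-Δ : ∀ c → ∑ (λ w → Δ c w) ≡ + 0
  ∑-Δ c = trans (∑-sumL es (edgeFlow c))
            (trans (sumL-cong es (λ e →
               trans (∑-+ (λ v → δ v (proj₁ e) * (c (proj₂ e) - c (proj₁ e)))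
                          (λ v → δ v (proj₂ e) * (c (proj₁ e) - c (proj₂ e))))
                (trans (cong₂ _+_ (∑-δ (proj₁ e) (λ _ → c (proj₂ e) - c (proj₁ e)))
                                  (∑-δ (proj₂ e) (λ _ → c (proj₁ e) - c (proj₂ e))))
                       (flow-cancel (c (proj₁ e)) (c (proj₂ e))))))
            (sumL-0 es))

  ~-by-Δ : ∀ {X Y : Div N} (c : Fin N → ℤ) → (∀ w → X w - Y w ≡ Δ c w) → LinEquiv H X Y
  ~-by-Δ c h = c , λ w → trans (h w) (sym (principal-Δ c w))

  ~-script : ∀ {X Y : Div N} → LinEquiv H X Y → Σ (Fin N → ℤ) λ c → ∀ w → X w - Y w ≡ Δ c w
  ~-script (c , h) = c , λ w → trans (h w) (principal-Δ c w)

  ~-diff : ∀ {A B A' B' : Div N} → LinEquiv H A B → (∀ w → A w - B w ≡ A' w - B' w) → LinEquiv H A' B'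
  ~-diff (c , h) eq = c , λ w → trans (sym (eq w)) (h w)

  private
    diff-sym : ∀ x y → y - x ≡ - (x - y)
    diff-sym = solve-∀
    diff-trans : ∀ x y z → x - z ≡ (x - y) + (y - z)
    diff-trans = solve-∀

  ~-refl : ∀ {X : Div N} → LinEquiv H X X
  ~-refl {X} = ~-by-Δ {X} {X} (λ _ → + 0) λ w → trans (ℤP.+-inverseʳ (X w)) (sym (Δ-0 w))

  ~-sym : ∀ {X Y : Div N} → LinEquiv H X Y → LinEquiv H Y X
  ~-sym {X} {Y} p with ~-script {X} {Y} p
  ... | c , h = ~-by-Δ {Y} {X} (λ v → - c v) λ w →
                  trans (diff-sym (X w) (Y w)) (trans (cong -_ (h w)) (sym (Δ-neg c w)))

  ~-trans : ∀ {X Y Z : Div N} → LinEquiv H X Y → LinEquiv H Y Z → LinEquiv H X Z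
  ~-trans {X} {Y} {Z} p q with ~-script {X} {Y} p | ~-script {Y} {Z} q
  ... | c , h | d , k = ~-by-Δ {X} {Z} (λ v → c v + d v) λ w →
          trans (diff-trans (X w) (Y w) (Z w)) (trans (cong₂ _+_ (h w) (k w)) (sym (Δ-+ c d w)))

  deg-~ : ∀ {X Y : Div N} → LinEquiv H X Y → deg X ≡ deg Y
  deg-~ {X} {Y} p with ~-script {X} {Y} p
  ... | c , h = ℤP.i-j≡0⇒i≡j _ _ (trans (sym (∑-- X Y)) (trans (∑-cong h) (∑-Δ c)))

-- An edge-injective ranking ρ : V → ℤ orients each edge
-- towards its higher-ranked end; this orientation is acyclic, and ν_ρ(v) is
-- its in-degree at v minus one.  ⟦ x < y ⟧ is the 0/1 indicator of x < y.

⟦_<_⟧ : ℤ → ℤ → ℤ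
⟦ x < y ⟧ = b2z (does (x ℤP.<? y))

⟦<⟧-yes : ∀ {x y} → x < y → ⟦ x < y ⟧ ≡ + 1
⟦<⟧-yes {x} {y} p with x ℤP.<? y
... | yes _ = refl
... | no ¬p = ⊥-elim (¬p p)

⟦<⟧-no : ∀ {x y} → ¬ (x < y) → ⟦ x < y ⟧ ≡ + 0
⟦<⟧-no {x} {y} ¬p with x ℤP.<? y
... | yes p = ⊥-elim (¬p p)
... | no _ = refl

⟦<⟧-neg : ∀ x y → ⟦ - x < - y ⟧ ≡ ⟦ y < x ⟧
⟦<⟧-neg x y = cong b2z (does-≡ (- x ℤP.<? - y) (y ℤP.<? x) ℤP.neg-cancel-< ℤP.neg-mono-<)

⟦<⟧-compl : ∀ {x y} → x ≢ y → ⟦ x < y ⟧ + ⟦ y < x ⟧ ≡ + 1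
⟦<⟧-compl {x} {y} ne with x ℤP.<? y | y ℤP.<? x
... | yes p | yes q = ⊥-elim (ℤP.<-asym p q)
... | yes p | no q = refl
... | no p | yes q = refl
... | no p | no q = ⊥-elim (ne (ℤP.≤-antisym (ℤP.≮⇒≥ q) (ℤP.≮⇒≥ p)))

best : ∀ {m} {A : Set} (R : A → A → Set) → (∀ x y → R x y ⊎ R y x) →
       (∀ {x y z} → R x y → R y z → R x z) → (f : Fin (suc m) → A) →
       Σ (Fin (suc m)) λ w → ∀ v → R (f w) (f v)
best {m} {A} R total R-trans f = go f
  where
  R-refl : ∀ x → R x x
  R-refl x with total x x
  ... | inj₁ r = r
  ... | inj₂ r = r
  go : ∀ {m} (f : Fin (suc m) → A) → Σ (Fin (suc m)) λ w → ∀ v → R (f w) (f v)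
  go {zero} f = zero , λ { zero → R-refl (f zero) }
  go {suc m} f with go (λ i → f (suc i))
  ... | w , h with total (f zero) (f (suc w))
  ... | inj₁ r = zero , λ { zero → R-refl (f zero) ; (suc v) → R-trans r (h v) }
  ... | inj₂ r = suc w , λ { zero → r ; (suc v) → h v }

MaxMin : ℤ × ℤ → ℤ × ℤ → Set
MaxMin (c₁ , r₁) (c₂ , r₂) = (c₂ < c₁) ⊎ (c₁ ≡ c₂ × r₁ ≤ r₂)

MaxMin-total : ∀ x y → MaxMin x y ⊎ MaxMin y x
MaxMin-total (c₁ , r₁) (c₂ , r₂) with ℤP.<-cmp c₁ c₂
... | tri< a _ _ = inj₂ (inj₁ a)
... | tri> _ _ c = inj₁ (inj₁ c)
... | tri≈ _ eq _ with ℤP.≤-total r₁ r₂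
... | inj₁ le = inj₁ (inj₂ (eq , le))
... | inj₂ le = inj₂ (inj₂ (sym eq , le))

MaxMin-trans : ∀ {x y z} → MaxMin x y → MaxMin y z → MaxMin x z
MaxMin-trans (inj₁ a) (inj₁ b) = inj₁ (ℤP.<-trans b a)
MaxMin-trans (inj₁ a) (inj₂ (refl , _)) = inj₁ a
MaxMin-trans (inj₂ (refl , _)) (inj₁ b) = inj₁ b
MaxMin-trans (inj₂ (refl , p)) (inj₂ (refl , q)) = inj₂ (refl , ℤP.≤-trans p q)

maxMinVertex : ∀ {k} → Fin k → (c ρ : Fin k → ℤ) →
               Σ (Fin k) λ w → (∀ v → c v ≤ c w) × (∀ v → c v ≡ c w → ρ w ≤ ρ v)
maxMinVertex {suc m} _ c ρ with best MaxMin MaxMin-total MaxMin-trans (λ v → c v , ρ v)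
... | w , h = w , (λ v → max (h v)) , (λ v eq → min (h v) eq)
  where
  max : ∀ {v} → MaxMin (c w , ρ w) (c v , ρ v) → c v ≤ c w
  max (inj₁ c<) = ℤP.<⇒≤ c<
  max (inj₂ (eq , _)) = ℤP.≤-reflexive (sym eq)
  min : ∀ {v} → MaxMin (c w , ρ w) (c v , ρ v) → c v ≡ c w → ρ w ≤ ρ v
  min (inj₁ c<) eq = ⊥-elim (ℤP.<-irrefl eq c<)
  min (inj₂ (_ , ρ≤)) eq = ρ≤

module Orientations {N : ℕ} (es : List (Fin N × Fin N)) (loopless : All (λ e → proj₁ e ≢ proj₂ e) es) where
  open Laplacian es loopless

  EdgeInjective : (Fin N → ℤ) → Set
  EdgeInjective ρ = All (λ e → ρ (proj₁ e) ≢ ρ (proj₂ e)) es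

  indeg : (Fin N → ℤ) → Fin N → ℤ
  indeg ρ v = nbrSum v (λ x → ⟦ ρ x < ρ v ⟧)

  ν[_] : (Fin N → ℤ) → Div N
  ν[ ρ ] v = indeg ρ v - + 1

  IsOrientDiv : Div N → Set
  IsOrientDiv ν = Σ (Fin N → ℤ) λ ρ → EdgeInjective ρ × (∀ v → ν v ≡ ν[ ρ ] v)

  K : Div N
  K v = nbrSum v (λ _ → + 1) - + 2

  private
    flip-at-first : ∀ l l' → + 1 * + 1 + + 0 * + 1 - (+ 1 * l + + 0 * l') ≡ + 1 - l
    flip-at-first = solve-∀
    flip-at-first' : ∀ l l' → + 1 * l + + 0 * l' ≡ l
    flip-at-first' = solve-∀
    flip-at-second : ∀ l l' → + 0 * + 1 + + 1 * + 1 - (+ 0 * l' + + 1 * l) ≡ + 1 - l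
    flip-at-second = solve-∀
    flip-at-second' : ∀ l l' → + 0 * l' + + 1 * l ≡ l
    flip-at-second' = solve-∀
    flip-elsewhere : ∀ l l' m m' → + 0 * + 1 + + 0 * + 1 - (+ 0 * l + + 0 * l') ≡ + 0 * m + + 0 * m'
    flip-elsewhere = solve-∀
    one-minus : ∀ a b → a + b ≡ + 1 → + 1 - b ≡ a
    one-minus a b eq = trans (cong (_- b) (sym eq)) (cancel a b)
      where cancel : ∀ a b → a + b - b ≡ a
            cancel = solve-∀

  -- reversing the orientation exchanges in- and out-edges at each edge end
  reverse-edge : ∀ (ρ : Fin N → ℤ) (v a b : Fin N) → ρ a ≢ ρ b →
    δ v a * + 1 + δ v b * + 1 - (δ v a * ⟦ ρ b < ρ v ⟧ + δ v b * ⟦ ρ a < ρ v ⟧)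
    ≡ δ v a * ⟦ - ρ b < - ρ v ⟧ + δ v b * ⟦ - ρ a < - ρ v ⟧
  reverse-edge ρ v a b ne with v ≟ a | v ≟ b
  ... | yes refl | yes refl = ⊥-elim (ne refl)
  ... | yes refl | no _ =
        trans (flip-at-first ⟦ ρ b < ρ v ⟧ ⟦ ρ v < ρ v ⟧)
         (trans (one-minus ⟦ ρ v < ρ b ⟧ ⟦ ρ b < ρ v ⟧ (⟦<⟧-compl ne))
          (trans (sym (⟦<⟧-neg (ρ b) (ρ v))) (sym (flip-at-first' ⟦ - ρ b < - ρ v ⟧ ⟦ - ρ v < - ρ v ⟧))))
  ... | no _ | yes refl =
        trans (flip-at-second ⟦ ρ a < ρ v ⟧ ⟦ ρ v < ρ v ⟧)
         (trans (one-minus ⟦ ρ v < ρ a ⟧ ⟦ ρ a < ρ v ⟧ (⟦<⟧-compl (λ eq → ne (sym eq))))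
          (trans (sym (⟦<⟧-neg (ρ a) (ρ v))) (sym (flip-at-second' ⟦ - ρ a < - ρ v ⟧ ⟦ - ρ v < - ρ v ⟧))))
  ... | no _ | no _ = flip-elsewhere ⟦ ρ b < ρ v ⟧ ⟦ ρ a < ρ v ⟧ ⟦ - ρ b < - ρ v ⟧ ⟦ - ρ a < - ρ v ⟧

  private
    K-minus-ν : ∀ s c → (s - + 2) - (c - + 1) ≡ (s - c) - + 1
    K-minus-ν = solve-∀

  reverse-orientation : ∀ {ν} → IsOrientDiv ν → IsOrientDiv (K ⊝ ν)
  reverse-orientation {ν} (ρ , inj , eq) = (λ v → - ρ v) , All-map (λ ne eq → ne (ℤP.neg-injective eq)) inj , λ v →
    begin
      K v - ν v
    ≡⟨ cong (λ z → K v - z) (eq v) ⟩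
      K v - ν[ ρ ] v
    ≡⟨ K-minus-ν (nbrSum v (λ _ → + 1)) (indeg ρ v) ⟩
      (nbrSum v (λ _ → + 1) - indeg ρ v) - + 1
    ≡⟨ cong (_- + 1) (sym (sumL-- (λ e → δ v (proj₁ e) * + 1 + δ v (proj₂ e) * + 1)
                                 (λ e → δ v (proj₁ e) * ⟦ ρ (proj₂ e) < ρ v ⟧ + δ v (proj₂ e) * ⟦ ρ (proj₁ e) < ρ v ⟧) es)) ⟩
      sumL (map (λ e → δ v (proj₁ e) * + 1 + δ v (proj₂ e) * + 1
                       - (δ v (proj₁ e) * ⟦ ρ (proj₂ e) < ρ v ⟧ + δ v (proj₂ e) * ⟦ ρ (proj₁ e) < ρ v ⟧)) es) - + 1
    ≡⟨ cong (_- + 1) (sumL-congᴬ inj (λ {e} ne → reverse-edge ρ v (proj₁ e) (proj₂ e) ne)) ⟩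
      ν[ (λ x → - ρ x) ] v
    ∎
    where open ≡-Reasoning

  -- deg ν_ρ = |E| − |V|: every edge is an in-edge at exactly one end
  deg-orientDiv : ∀ ρ → EdgeInjective ρ → deg ν[ ρ ] ≡ + length es - + N
  deg-orientDiv ρ inj =
    trans (∑-- (indeg ρ) (λ _ → + 1))
     (cong₂ _-_
       (trans (∑-sumL es (λ v e → δ v (proj₁ e) * ⟦ ρ (proj₂ e) < ρ v ⟧ + δ v (proj₂ e) * ⟦ ρ (proj₁ e) < ρ v ⟧))
        (trans (sumL-congᴬ inj (λ {e} ne →
            trans (∑-+ (λ v → δ v (proj₁ e) * ⟦ ρ (proj₂ e) < ρ v ⟧) (λ v → δ v (proj₂ e) * ⟦ ρ (proj₁ e) < ρ v ⟧))
             (trans (cong₂ _+_ (∑-δ (proj₁ e) (λ v → ⟦ ρ (proj₂ e) < ρ v ⟧))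
                               (∑-δ (proj₂ e) (λ v → ⟦ ρ (proj₁ e) < ρ v ⟧)))
                    (⟦<⟧-compl (λ eq → ne (sym eq))))))
         (sumL-1 es)))
       (trans (∑-const {N} (+ 1)) (ℤP.*-identityʳ (+ N))))

  private
    plus-zero : ∀ x y → x - y + + 0 ≡ x - y
    plus-zero = solve-∀
    plus-one : ∀ x y → x + + 1 - y ≡ (x - y) + + 1
    plus-one = solve-∀

  -- an edge from w to a neighbour b with c b ≤ c w, where ρ w is minimal
  -- among the maximisers of c, contributes at most 0 to (Δc + indeg)(w)
  flow+in≤0 : ∀ cw cb ρw ρb → cb ≤ cw → (cb ≡ cw → ρw ≤ ρb) → (cb - cw) + ⟦ ρb < ρw ⟧ ≤ + 0
  flow+in≤0 cw cb ρw ρb cb≤cw tie with ρb ℤP.<? ρw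
  ... | no _ = ≤-cast (ℤP.i≤j⇒i-j≤0 cb≤cw) (sym (plus-zero cb cw)) refl
  ... | yes ρb<ρw with cb ℤP.≟ cw
  ...   | yes eq = ⊥-elim (ℤP.<⇒≱ ρb<ρw (tie eq))
  ...   | no ne = ≤-cast (ℤP.i≤j⇒i-j≤0 {cb + + 1} {cw} (<⇒+1≤ (ℤP.≤∧≢⇒< cb≤cw ne))) (plus-one cb cw) refl

  private
    edge-at-first : ∀ ca cb l l' → + 1 * (cb - ca) + + 0 * (ca - cb) + (+ 1 * l + + 0 * l') ≡ (cb - ca) + l
    edge-at-first = solve-∀
    edge-at-second : ∀ ca cb l l' → + 0 * (cb - ca) + + 1 * (ca - cb) + (+ 0 * l' + + 1 * l) ≡ (ca - cb) + l
    edge-at-second = solve-∀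
    edge-elsewhere : ∀ x y l l' → + 0 * x + + 0 * y + (+ 0 * l + + 0 * l') ≡ + 0
    edge-elsewhere = solve-∀

  flow+in-edge≤0 : ∀ (c ρ : Fin N → ℤ) w → (∀ v → c v ≤ c w) → (∀ v → c v ≡ c w → ρ w ≤ ρ v) →
                   ∀ a b → ρ a ≢ ρ b →
                   edgeFlow c w (a , b) + (δ w a * ⟦ ρ b < ρ w ⟧ + δ w b * ⟦ ρ a < ρ w ⟧) ≤ + 0
  flow+in-edge≤0 c ρ w max min a b ne with w ≟ a | w ≟ b
  ... | yes refl | yes refl = ⊥-elim (ne refl)
  ... | yes refl | no _ = ≤-cast (flow+in≤0 (c w) (c b) (ρ w) (ρ b) (max b) (min b))
                                 (sym (edge-at-first (c w) (c b) ⟦ ρ b < ρ w ⟧ ⟦ ρ w < ρ w ⟧)) refl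
  ... | no _ | yes refl = ≤-cast (flow+in≤0 (c w) (c a) (ρ w) (ρ a) (max a) (min a))
                                 (sym (edge-at-second (c a) (c w) ⟦ ρ a < ρ w ⟧ ⟦ ρ w < ρ w ⟧)) refl
  ... | no _ | no _ = ≤-cast ℤP.≤-refl (sym (edge-elsewhere (c b - c a) (c a - c b) ⟦ ρ b < ρ w ⟧ ⟦ ρ a < ρ w ⟧)) refl

  private
    solve-E : ∀ e ν l → e - ν ≡ l → e ≡ (l + (ν + + 1)) - + 1
    solve-E e ν l eq = trans (split e ν) (cong (λ z → (z + (ν + + 1)) - + 1) eq)
      where split : ∀ e ν → e ≡ ((e - ν) + (ν + + 1)) - + 1
            split = solve-∀
    pred-suc : ∀ c → c ≡ (c - + 1) + + 1
    pred-suc = solve-∀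

  -- (N1)  |ν_ρ| = ∅: if E ≥ 0 and E − ν_ρ = Δc, then E < 0 at a vertex
  -- maximising c and, among those, minimising ρ
  orientDiv-not-effective : Fin N → ∀ {ν} → IsOrientDiv ν → ¬ LinSysNonempty H ν
  orientDiv-not-effective q {ν} (ρ , inj , eqν) (E , E≥0 , E~ν) with ~-script {E} {ν} E~ν
  ... | c , h with maxMinVertex q c ρ
  ... | w , max , min = ℤP.<-irrefl refl (ℤP.≤-<-trans (E≥0 w) Ew<0)
    where
    Δ+indeg≤0 : Δ c w + indeg ρ w ≤ + 0
    Δ+indeg≤0 = ≤-cast (sumL-monoᴬ inj (λ {e} ne → flow+in-edge≤0 c ρ w max min (proj₁ e) (proj₂ e) ne))
                       (sumL-+ (edgeFlow c w) _ es) (sumL-0 es)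
    Ew<0 : E w < + 0
    Ew<0 = ℤP.≤-<-trans (ℤP.≤-reflexive (trans (solve-E (E w) (ν w) (Δ c w) (h w))
                          (cong (λ z → (Δ c w + (z + + 1)) - + 1) (eqν w))))
             (ℤP.≤-<-trans (ℤP.+-monoˡ-≤ (- + 1) (≤-cast Δ+indeg≤0 (cong (λ z → Δ c w + z) (pred-suc (indeg ρ w))) refl))
                (ℤ.-<+ {0} {0}))

-- Fix a divisor X and a vertex q.  A fire starts
-- at q; an unburnt vertex v catches fire when X(v) is less than the number of
-- edges joining v to burnt vertices.  A burning order ρ : V → ℕ (burning
-- times, with all unburnt vertices at the current time k) is maintained.
-- Either every vertex burns, giving an acyclic orientation ρ with
-- X(v) < indeg_ρ(v) for v ≠ q, or the fire stops with an unburnt set that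
-- can be fired.

⟦<⟧-ℕ : ∀ a b → ⟦ + a < + b ⟧ ≡ b2z (does (a ℕ.<? b))
⟦<⟧-ℕ a b = cong b2z (does-≡ (+ a ℤP.<? + b) (a ℕ.<? b) ℤP.drop‿+<+ ℤ.+<+)

-- case distinction on a decision, by pattern matching on it, so that
-- 'with' on the decision reduces it
if?_then_else_ : ∀ {P A : Set} → Dec P → A → A → A
if? yes _ then a else b = a
if? no _ then a else b = b

-- the number of unburnt vertices decreases during the algorithm
unburnt : ∀ {N} → (Fin N → ℕ) → ℕ → Fin N → ℕ
unburnt ρ k w = if? ρ w ℕ.<? k then 0 else 1

unburnt-< : ∀ {N} {ρ : Fin N → ℕ} {k w} → ρ w ℕ.< k → unburnt ρ k w ≡ 0
unburnt-< {ρ = ρ} {k} {w} p with ρ w ℕ.<? k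
... | yes _ = refl
... | no ¬p = ⊥-elim (¬p p)

unburnt-≮ : ∀ {N} {ρ : Fin N → ℕ} {k w} → ¬ (ρ w ℕ.< k) → unburnt ρ k w ≡ 1
unburnt-≮ {ρ = ρ} {k} {w} p with ρ w ℕ.<? k
... | yes q = ⊥-elim (p q)
... | no _ = refl

unburnt-≤1 : ∀ {N} (ρ : Fin N → ℕ) k w → unburnt ρ k w ℕ.≤ 1
unburnt-≤1 ρ k w with ρ w ℕ.<? k
... | yes _ = ℕ.z≤n
... | no _ = ℕ.s≤s ℕ.z≤n

module Burning {N : ℕ} (es : List (Fin N × Fin N)) (loopless : All (λ e → proj₁ e ≢ proj₂ e) es)
               (X : Div N) (q : Fin N) where
  open Laplacian es loopless
  open Orientations es loopless

  indegℕ : (Fin N → ℕ) → Fin N → ℤ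
  indegℕ ρ v = indeg (λ x → + ρ x) v

  record BurnState (ρ : Fin N → ℕ) (k : ℕ) : Set where
    field
      q-first : ρ q ≡ 0
      started : 1 ℕ.≤ k
      unburnt-at-k : ∀ w → ρ w ℕ.≤ k
      burnt-distinct : ∀ v w → ρ v ℕ.< k → ρ v ≡ ρ w → v ≡ w
      caught-fire : ∀ v → v ≢ q → ρ v ℕ.< k → X v < indegℕ ρ v

  AllBurnt : Set
  AllBurnt = Σ (Fin N → ℕ) λ ρ → (∀ v w → ρ v ≡ ρ w → v ≡ w) × ρ q ≡ 0 × (∀ v → v ≢ q → X v < indegℕ ρ v)

  Stuck : Set
  Stuck = Σ (Fin N → ℕ) λ ρ → Σ ℕ λ k → BurnState ρ k × (Σ (Fin N) λ u → ρ u ≡ k) ×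
          (∀ u → ρ u ≡ k → indegℕ ρ u ≤ X u)

  indeg-ext : ∀ (ρ ρ' : Fin N → ℕ) v → (∀ x → (ρ' x ℕ.< ρ' v) → ρ x ℕ.< ρ v) →
              (∀ x → ρ x ℕ.< ρ v → ρ' x ℕ.< ρ' v) → indegℕ ρ' v ≡ indegℕ ρ v
  indeg-ext ρ ρ' v f g = sumL-cong es (λ e → cong₂ _+_ (cong (δ v (proj₁ e) *_) (same (proj₂ e)))
                                                      (cong (δ v (proj₂ e) *_) (same (proj₁ e))))
    where
    same : ∀ x → ⟦ + ρ' x < + ρ' v ⟧ ≡ ⟦ + ρ x < + ρ v ⟧
    same x = trans (⟦<⟧-ℕ (ρ' x) (ρ' v))
              (trans (cong b2z (does-≡ (ρ' x ℕ.<? ρ' v) (ρ x ℕ.<? ρ v) (f x) (g x)))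
                     (sym (⟦<⟧-ℕ (ρ x) (ρ v))))

  ρ₀ : Fin N → ℕ
  ρ₀ w = if? w ≟ q then 0 else 1

  ρ₀<1 : ∀ {w} → ρ₀ w ℕ.< 1 → w ≡ q
  ρ₀<1 {w} p with w ≟ q
  ... | yes e = e
  ... | no _ = ⊥-elim (ℕP.<-irrefl refl p)

  initial : BurnState ρ₀ 1
  initial = record
    { q-first = q-first
    ; started = ℕP.≤-refl
    ; unburnt-at-k = ρ₀≤1
    ; burnt-distinct = λ v w p eq → trans (ρ₀<1 p) (sym (ρ₀<1 (subst (ℕ._< 1) eq p)))
    ; caught-fire = λ v ne p → ⊥-elim (ne (ρ₀<1 p)) }
    where
    q-first : ρ₀ q ≡ 0
    q-first with q ≟ q
    ... | yes _ = refl
    ... | no ¬p = ⊥-elim (¬p refl)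
    ρ₀≤1 : ∀ w → ρ₀ w ℕ.≤ 1
    ρ₀≤1 w with w ≟ q
    ... | yes _ = ℕ.z≤n
    ... | no _ = ℕP.≤-refl

  module BurnStep (ρ : Fin N → ℕ) (k : ℕ) (st : BurnState ρ k) (v : Fin N) (ρv≡k : ρ v ≡ k)
                  (v-fire : X v < indegℕ ρ v) where
    open BurnState st

    ρ' : Fin N → ℕ
    ρ' w = if? ρ w ℕ.<? k then ρ w else (if? w ≟ v then k else suc k)

    Fate : Fin N → Set
    Fate w = (ρ w ℕ.< k × ρ' w ≡ ρ w) ⊎ ((ρ w ≡ k × w ≡ v × ρ' w ≡ k) ⊎ (ρ w ≡ k × w ≢ v × ρ' w ≡ suc k))

    fate : ∀ w → Fate w
    fate w with ρ w ℕ.<? k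
    ... | yes p = inj₁ (p , refl)
    ... | no ¬p with ℕP.m≤n⇒m<n∨m≡n (unburnt-at-k w)
    ...   | inj₁ p = ⊥-elim (¬p p)
    ...   | inj₂ e with w ≟ v
    ...     | yes wv = inj₂ (inj₁ (e , wv , refl))
    ...     | no wv = inj₂ (inj₂ (e , wv , refl))

    precedes→ : ∀ w → ρ' w ≡ ρ w → ρ w ℕ.≤ k → ∀ x → ρ' x ℕ.< ρ' w → ρ x ℕ.< ρ w
    precedes→ w ew wk x lx with fate x
    ... | inj₁ (px , ex) = subst₂ ℕ._<_ ex ew lx
    ... | inj₂ (inj₁ (e , _ , ex)) = ⊥-elim (ℕP.<-irrefl refl (ℕP.<-≤-trans lx (ℕP.≤-trans (ℕP.≤-reflexive ew) (ℕP.≤-trans wk (ℕP.≤-reflexive (sym ex))))))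
    ... | inj₂ (inj₂ (e , _ , ex)) = ⊥-elim (ℕP.<-irrefl refl (ℕP.<-≤-trans lx (ℕP.≤-trans (ℕP.≤-reflexive ew) (ℕP.≤-trans wk (ℕP.≤-trans (ℕP.n≤1+n k) (ℕP.≤-reflexive (sym ex)))))))

    precedes← : ∀ w → ρ' w ≡ ρ w → ρ w ℕ.≤ k → ∀ x → ρ x ℕ.< ρ w → ρ' x ℕ.< ρ' w
    precedes← w ew wk x lx with fate x
    ... | inj₁ (px , ex) = subst₂ ℕ._<_ (sym ex) (sym ew) lx
    ... | inj₂ (inj₁ (e , _ , _)) = ⊥-elim (ℕP.<-irrefl refl (ℕP.<-≤-trans lx (ℕP.≤-trans wk (ℕP.≤-reflexive (sym e)))))
    ... | inj₂ (inj₂ (e , _ , _)) = ⊥-elim (ℕP.<-irrefl refl (ℕP.<-≤-trans lx (ℕP.≤-trans wk (ℕP.≤-reflexive (sym e)))))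

    next : BurnState ρ' (suc k)
    next = record { q-first = q-first' ; started = ℕ.s≤s ℕ.z≤n ; unburnt-at-k = unburnt-at-k'
                  ; burnt-distinct = burnt-distinct' ; caught-fire = caught-fire' }
      where
      q-first' : ρ' q ≡ 0
      q-first' with fate q
      ... | inj₁ (_ , e) = trans e q-first
      ... | inj₂ (inj₁ (e , _ , _)) = ⊥-elim (ℕP.<-irrefl (trans (sym q-first) e) started)
      ... | inj₂ (inj₂ (e , _ , _)) = ⊥-elim (ℕP.<-irrefl (trans (sym q-first) e) started)
      unburnt-at-k' : ∀ w → ρ' w ℕ.≤ suc k
      unburnt-at-k' w with fate w
      ... | inj₁ (p , e) = subst (ℕ._≤ suc k) (sym e) (ℕP.<⇒≤ (ℕP.<-trans p (ℕP.n<1+n k)))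
      ... | inj₂ (inj₁ (_ , _ , e)) = subst (ℕ._≤ suc k) (sym e) (ℕP.n≤1+n k)
      ... | inj₂ (inj₂ (_ , _ , e)) = ℕP.≤-reflexive e
      burnt-distinct' : ∀ x y → ρ' x ℕ.< suc k → ρ' x ≡ ρ' y → x ≡ y
      burnt-distinct' x y lx exy with fate x | fate y
      ... | inj₁ (px , ex) | inj₁ (py , ey) = burnt-distinct x y px (trans (sym ex) (trans exy ey))
      ... | inj₁ (px , ex) | inj₂ (inj₁ (_ , _ , ey)) = ⊥-elim (ℕP.<-irrefl (trans (sym ex) (trans exy ey)) px)
      ... | inj₁ (px , ex) | inj₂ (inj₂ (_ , _ , ey)) = ⊥-elim (ℕP.<-irrefl refl (ℕP.<-trans px (ℕP.≤-reflexive (trans (sym ey) (trans (sym exy) ex)))))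
      ... | inj₂ (inj₁ (_ , xv , ex)) | inj₁ (py , ey) = ⊥-elim (ℕP.<-irrefl (trans (sym ey) (trans (sym exy) ex)) py)
      ... | inj₂ (inj₁ (_ , xv , _)) | inj₂ (inj₁ (_ , yv , _)) = trans xv (sym yv)
      ... | inj₂ (inj₁ (_ , _ , ex)) | inj₂ (inj₂ (_ , _ , ey)) = ⊥-elim (ℕP.<-irrefl (trans (sym ex) (trans exy ey)) (ℕP.n<1+n k))
      ... | inj₂ (inj₂ (_ , _ , ex)) | _ = ⊥-elim (ℕP.<-irrefl ex lx)
      caught-fire' : ∀ w → w ≢ q → ρ' w ℕ.< suc k → X w < indegℕ ρ' w
      caught-fire' w ne lw with fate w
      ... | inj₁ (pw , ew) = subst (X w <_) (sym (indeg-ext ρ ρ' w (precedes→ w ew (ℕP.<⇒≤ pw)) (precedes← w ew (ℕP.<⇒≤ pw))))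
                                   (caught-fire w ne pw)
      ... | inj₂ (inj₁ (e , refl , ew)) = subst (X w <_) (sym (indeg-ext ρ ρ' w (precedes→ w (trans ew (sym e)) (ℕP.≤-reflexive e))
                                                                              (precedes← w (trans ew (sym e)) (ℕP.≤-reflexive e))))
                                                v-fire
      ... | inj₂ (inj₂ (_ , _ , ew)) = ⊥-elim (ℕP.<-irrefl ew lw)

    unburnt-mono : ∀ w → unburnt ρ' (suc k) w ℕ.≤ unburnt ρ k w
    unburnt-mono w with fate w
    ... | inj₁ (p , e) = ℕP.≤-reflexive (trans (unburnt-< {ρ = ρ'} {suc k} {w} (subst (ℕ._< suc k) (sym e) (ℕP.<-trans p (ℕP.n<1+n k))))
                                                (sym (unburnt-< {ρ = ρ} p)))
    ... | inj₂ (inj₁ (_ , _ , e)) = ℕP.≤-trans (ℕP.≤-reflexive (unburnt-< {ρ = ρ'} {suc k} {w} (subst (ℕ._< suc k) (sym e) (ℕP.n<1+n k)))) ℕ.z≤n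
    ... | inj₂ (inj₂ (e , _ , _)) = subst (unburnt ρ' (suc k) w ℕ.≤_) (sym (unburnt-≮ {ρ = ρ} (λ p → ℕP.<-irrefl e p))) (unburnt-≤1 ρ' (suc k) w)

    v-burns : unburnt ρ' (suc k) v ℕ.< unburnt ρ k v
    v-burns with fate v
    ... | inj₁ (p , _) = ⊥-elim (ℕP.<-irrefl ρv≡k p)
    ... | inj₂ (inj₂ (_ , vv , _)) = ⊥-elim (vv refl)
    ... | inj₂ (inj₁ (_ , _ , e)) = subst₂ ℕ._<_ (sym (unburnt-< {ρ = ρ'} {suc k} {v} (subst (ℕ._< suc k) (sym e) (ℕP.n<1+n k))))
                                               (sym (unburnt-≮ {ρ = ρ} (λ p → ℕP.<-irrefl ρv≡k p))) (ℕ.s≤s ℕ.z≤n)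

  mutual
    burn : ∀ fuel ρ k → BurnState ρ k → ∑ℕ (unburnt ρ k) ℕ.≤ fuel → AllBurnt ⊎ Stuck
    burn fuel ρ k st bnd with FP.any? (λ v → (ρ v ℕ.≟ k) ×-dec (X v ℤP.<? indegℕ ρ v))
    ... | yes (v , e , l) = burnVertex fuel ρ k st bnd v e l
    ... | no ¬fire with FP.any? (λ u → ρ u ℕ.≟ k)
    ...   | yes (u , e) = inj₂ (ρ , k , st , (u , e) , λ u' e' → ℤP.≮⇒≥ (λ l → ¬fire (u' , e' , l)))
    ...   | no ¬u = inj₁ (ρ , (λ v w eq → BurnState.burnt-distinct st v w (all-burnt v) eq) , BurnState.q-first st ,
                          λ v ne → BurnState.caught-fire st v ne (all-burnt v))
      where
      all-burnt : ∀ v → ρ v ℕ.< k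
      all-burnt v = ℕP.≤∧≢⇒< (BurnState.unburnt-at-k st v) (λ e → ¬u (v , e))

    burnVertex : ∀ fuel ρ k → BurnState ρ k → ∑ℕ (unburnt ρ k) ℕ.≤ fuel → ∀ v → ρ v ≡ k → X v < indegℕ ρ v →
                 AllBurnt ⊎ Stuck
    burnVertex zero ρ k st bnd v e l =
      ⊥-elim (ℕP.<-irrefl refl (ℕP.<-≤-trans (ℕP.<-≤-trans (ℕ.s≤s ℕ.z≤n)
        (ℕP.≤-trans (ℕP.≤-reflexive (sym (unburnt-≮ {ρ = ρ} {k} {v} (λ p → ℕP.<-irrefl e p)))) (∑ℕ-single (unburnt ρ k) v))) bnd))
    burnVertex (suc fuel) ρ k st bnd v e l =
      burn fuel (BurnStep.ρ' ρ k st v e l) (suc k) (BurnStep.next ρ k st v e l)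
           (ℕP.≤-pred (ℕP.<-≤-trans (∑ℕ-strict (BurnStep.unburnt-mono ρ k st v e l) v (BurnStep.v-burns ρ k st v e l)) bnd))

  burnAll : AllBurnt ⊎ Stuck
  burnAll = burn _ ρ₀ 1 initial ℕP.≤-refl

-- Fix q with D(q) < 0.  A script c is admissible if c ≥ 0, c(q) = 0, and at
-- every vertex D + Δc is nonnegative or at least D.  Starting from c = 0,
-- run the burning algorithm on D + Δc: if it gets stuck, adding the
-- indicator of the unburnt set to c keeps c admissible and raises ∑ c; if
-- everything burns, the burning order ρ satisfies D + Δc ≤ ν_ρ away from q.
-- Admissible scripts are bounded, so this terminates.  Then either
-- (D + Δc)(q) < 0, and D ∼ ν_ρ − F, or the negative part of D has strictly
-- decreased and we recurse on D + Δc.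

∣∣-lb : ∀ x → - (+ ℤ.∣ x ∣) ≤ x
∣∣-lb (+ n) = ℤP.≤-trans (ℤP.neg-≤-pos {n} {0}) (ℤ.+≤+ ℕ.z≤n)
∣∣-lb -[1+ n ] = ℤP.≤-refl

∣∣-ub : ∀ x → x ≤ + ℤ.∣ x ∣
∣∣-ub (+ n) = ℤP.≤-refl
∣∣-ub -[1+ n ] = ℤ.-≤+

∣∣-nonneg : ∀ x → + 0 ≤ + ℤ.∣ x ∣
∣∣-nonneg x = ℤ.+≤+ ℕ.z≤n

module Reduction {N : ℕ} (es : List (Fin N × Fin N)) (loopless : All (λ e → proj₁ e ≢ proj₂ e) es)
                 (conn : Connected (graph N es [])) (D : Div N) (q : Fin N) where
  open Laplacian es loopless
  open Orientations es loopless

  fired : (Fin N → ℤ) → Div N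
  fired c v = D v + Δ c v

  Admissible : (Fin N → ℤ) → Set
  Admissible c = (∀ v → + 0 ≤ c v) × (c q ≡ + 0) × (∀ v → (+ 0 ≤ fired c v) ⊎ (D v ≤ fired c v))

  -- Firing the unburnt set U of a stuck burning process.  Each unburnt
  -- vertex loses exactly its edges to burnt vertices, of which it has at
  -- most X(u); burnt vertices only gain.
  module FireUnburnt (c : Fin N → ℤ) (adm : Admissible c) (ρ : Fin N → ℕ) (k : ℕ)
                     (st : Burning.BurnState es loopless (fired c) q ρ k)
                     (u₀ : Fin N) (u₀-unburnt : ρ u₀ ≡ k)
                     (stuck : ∀ u → ρ u ≡ k → Burning.indegℕ es loopless (fired c) q ρ u ≤ fired c u) where
    open Burning es loopless (fired c) q using (indegℕ; module BurnState)
    open BurnState st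

    U : Fin N → ℤ
    U w = 𝟙 (ρ w ℕ.≟ k)

    U-rank : ∀ x → U x ≡ + 1 - ⟦ + ρ x < + k ⟧
    U-rank x with ρ x ℕ.≟ k
    ... | yes e = sym (cong (λ z → + 1 - z) (⟦<⟧-no (λ p → ℕP.<-irrefl e (ℤP.drop‿+<+ p))))
    ... | no ne = sym (cong (λ z → + 1 - z) (⟦<⟧-yes (ℤ.+<+ (ℕP.≤∧≢⇒< (unburnt-at-k x) ne))))

    private
      expand-flow : ∀ da db ua ub → da * (ub - ua) + db * (ua - ub) ≡ (da * ub - da * ua) + (db * ua - db * ub)
      expand-flow = solve-∀
      unburnt-flow : ∀ da db la lb → (da * (+ 1 - lb) - da * + 1) + (db * (+ 1 - la) - db * + 1) ≡ - (da * lb + db * la)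
      unburnt-flow = solve-∀
      burnt-flow : ∀ da db ua ub → (da * ub - da * + 0) + (db * ua - db * + 0) ≡ da * ub + db * ua
      burnt-flow = solve-∀

    flow-U : ∀ v a b → edgeFlow U v (a , b) ≡ (δ v a * U b - δ v a * U v) + (δ v b * U a - δ v b * U v)
    flow-U v a b = trans (expand-flow (δ v a) (δ v b) (U a) (U b))
                         (cong₂ _+_ (cong (λ z → δ v a * U b - z) (sym (δ-subst v a U)))
                                    (cong (λ z → δ v b * U a - z) (sym (δ-subst v b U))))

    ΔU-unburnt : ∀ v → ρ v ≡ k → Δ U v ≡ - indegℕ ρ v
    ΔU-unburnt v ρv≡k =
      trans (sumL-cong es (λ e → edge (proj₁ e) (proj₂ e)))
            (sumL-neg (λ e → δ v (proj₁ e) * ⟦ + ρ (proj₂ e) < + ρ v ⟧ + δ v (proj₂ e) * ⟦ + ρ (proj₁ e) < + ρ v ⟧) es)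
      where
      Ux : ∀ x → U x ≡ + 1 - ⟦ + ρ x < + ρ v ⟧
      Ux x = trans (U-rank x) (cong (λ z → + 1 - ⟦ + ρ x < + z ⟧) (sym ρv≡k))
      edge : ∀ a b → edgeFlow U v (a , b) ≡ - (δ v a * ⟦ + ρ b < + ρ v ⟧ + δ v b * ⟦ + ρ a < + ρ v ⟧)
      edge a b =
        begin
          edgeFlow U v (a , b)
        ≡⟨ flow-U v a b ⟩
          (δ v a * U b - δ v a * U v) + (δ v b * U a - δ v b * U v)
        ≡⟨ cong₂ _+_ (cong₂ (λ z y → δ v a * z - δ v a * y) (Ux b) (𝟙-yes (ρ v ℕ.≟ k) ρv≡k))
                     (cong₂ (λ z y → δ v b * z - δ v b * y) (Ux a) (𝟙-yes (ρ v ℕ.≟ k) ρv≡k)) ⟩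
          (δ v a * (+ 1 - ⟦ + ρ b < + ρ v ⟧) - δ v a * + 1) + (δ v b * (+ 1 - ⟦ + ρ a < + ρ v ⟧) - δ v b * + 1)
        ≡⟨ unburnt-flow (δ v a) (δ v b) ⟦ + ρ a < + ρ v ⟧ ⟦ + ρ b < + ρ v ⟧ ⟩
          - (δ v a * ⟦ + ρ b < + ρ v ⟧ + δ v b * ⟦ + ρ a < + ρ v ⟧)
        ∎
        where open ≡-Reasoning

    ΔU-burnt : ∀ v → ρ v ≢ k → + 0 ≤ Δ U v
    ΔU-burnt v ρv≢k = sumL-nonneg es (λ e → ≤-cast (edge≥0 (proj₁ e) (proj₂ e)) refl (sym (edge (proj₁ e) (proj₂ e))))
      where
      edge : ∀ a b → edgeFlow U v (a , b) ≡ δ v a * U b + δ v b * U a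
      edge a b = trans (flow-U v a b)
                   (trans (cong (λ z → (δ v a * U b - δ v a * z) + (δ v b * U a - δ v b * z)) (𝟙-no (ρ v ℕ.≟ k) ρv≢k))
                          (burnt-flow (δ v a) (δ v b) (U a) (U b)))
      edge≥0 : ∀ a b → + 0 ≤ δ v a * U b + δ v b * U a
      edge≥0 a b = ℤP.+-mono-≤ (0≤* (δ-nonneg v a) (𝟙-nonneg (ρ b ℕ.≟ k))) (0≤* (δ-nonneg v b) (𝟙-nonneg (ρ a ℕ.≟ k)))

    c⁺ : Fin N → ℤ
    c⁺ w = c w + U w

    fired-c⁺ : ∀ v → fired c⁺ v ≡ fired c v + Δ U v
    fired-c⁺ v = trans (cong (λ z → D v + z) (Δ-+ c U v)) (sym (ℤP.+-assoc (D v) (Δ c v) (Δ U v)))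

    admissible⁺ : Admissible c⁺
    admissible⁺ = (λ v → ℤP.+-mono-≤ (proj₁ adm v) (𝟙-nonneg _)) ,
                  trans (cong₂ _+_ (proj₁ (proj₂ adm)) (𝟙-no (ρ q ℕ.≟ k) (λ e → ℕP.<-irrefl (trans (sym q-first) e) started))) refl ,
                  nonneg-or-above
      where
      gains : ∀ {v} → ρ v ≢ k → fired c v ≤ fired c⁺ v
      gains {v} ne = ≤-cast (ℤP.+-mono-≤ (ℤP.≤-refl {fired c v}) (ΔU-burnt v ne)) (ℤP.+-identityʳ _) (sym (fired-c⁺ v))
      nonneg-or-above : ∀ v → (+ 0 ≤ fired c⁺ v) ⊎ (D v ≤ fired c⁺ v)
      nonneg-or-above v with ρ v ℕ.≟ k
      ... | yes e = inj₁ (≤-cast (ℤP.i≤j⇒0≤j-i (stuck v e)) refl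
                                 (trans (cong (λ z → fired c v + z) (sym (ΔU-unburnt v e))) (sym (fired-c⁺ v))))
      ... | no ne with proj₂ (proj₂ adm) v
      ...   | inj₁ p = inj₁ (ℤP.≤-trans p (gains ne))
      ...   | inj₂ p = inj₂ (ℤP.≤-trans p (gains ne))

    ∑-increases : ∑ c + + 1 ≤ ∑ c⁺
    ∑-increases = ≤-cast (ℤP.+-mono-≤ (ℤP.≤-refl {∑ c})
                           (≤-cast (∑-single (λ i → 𝟙-nonneg (ρ i ℕ.≟ k)) u₀) (𝟙-yes (ρ u₀ ℕ.≟ k) u₀-unburnt) refl))
                         refl (sym (∑-+ c U))

  Crossing : (Fin N → ℤ) → ℤ → Set
  Crossing c t = Σ (Fin N × Fin N) λ e → e ∈ es ×
                 ((t ≤ c (proj₁ e) × c (proj₂ e) < t) ⊎ (t ≤ c (proj₂ e) × c (proj₁ e) < t))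

  crossing : ∀ (c : Fin N → ℤ) t {v u} → Reach H v u → t ≤ c v → c u < t → Crossing c t
  crossing c t here tv ut = ⊥-elim (ℤP.<-irrefl refl (ℤP.<-≤-trans ut tv))
  crossing c t (stepF {w = w} m r) tv ut with t ℤP.≤? c w
  ... | yes tw = crossing c t r tw ut
  ... | no tw = (_ , w) , m , inj₁ (tv , ℤP.≰⇒> tw)
  crossing c t (stepB {w = w} m r) tv ut with t ℤP.≤? c w
  ... | yes tw = crossing c t r tw ut
  ... | no tw = (w , _) , m , inj₂ (tv , ℤP.≰⇒> tw)

  ‖D‖ : ℤ
  ‖D‖ = ∑ (λ v → + ℤ.∣ D v ∣)

  -- width of the gaps in the values of an admissible script
  W : ℕ
  W = suc (∑ℕ (λ v → ℤ.∣ D v ∣))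

  +1+‖D‖≡W : + 1 + ‖D‖ ≡ + W
  +1+‖D‖≡W = trans (cong (λ z → + 1 + z) (∑-pos (λ v → ℤ.∣ D v ∣))) (sym (ℤP.pos-+ 1 _))

  private
    distrib-indicator : ∀ A Y Z (da db : ℤ) → A * (da * Y + db * Z) ≡ da * (A * Y) + db * (A * Z)
    distrib-indicator = solve-∀
    both-above : ∀ x y → + 1 * (y - x) + + 1 * (x - y) ≡ + 0
    both-above = solve-∀
    first-above : ∀ x y → + 1 * (y - x) + + 0 * (x - y) ≡ y - x
    first-above = solve-∀
    second-above : ∀ x y → + 0 * (y - x) + + 1 * (x - y) ≡ x - y
    second-above = solve-∀
    none-above : ∀ x y → + 0 * (y - x) + + 0 * (x - y) ≡ + 0
    none-above = solve-∀
    Δ-from-fired : ∀ d l → l ≡ (d + l) - d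
    Δ-from-fired = solve-∀
    gap-arith : ∀ ca cb t S → (t + (+ 1 + S)) - (ca + + 1) ≡ ((cb - ca) - - S) + (t - (cb + + 1)) + + 1
    gap-arith = solve-∀

  -- Gap lemma: if an admissible c reaches a level t ≥ 1, some vertex has
  -- its value in [t, t + W).  The total outflow Σ_{c(u) ≥ t} Δc(u) is at
  -- least −‖D‖ and at most (c(b) − c(a)) for each crossing edge a → b.
  module Gap (c : Fin N → ℤ) (adm : Admissible c) (t : ℤ) (1≤t : + 1 ≤ t) where
    above : Fin N → ℤ
    above u = 𝟙 (t ℤP.≤? c u)

    flowOut : Fin N × Fin N → ℤ
    flowOut e = above (proj₁ e) * (c (proj₂ e) - c (proj₁ e)) + above (proj₂ e) * (c (proj₁ e) - c (proj₂ e))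

    ∑-above-Δ : ∑ (λ u → above u * Δ c u) ≡ sumL (map flowOut es)
    ∑-above-Δ =
      trans (∑-cong (λ u → sym (sumL-* (above u) (edgeFlow c u) es)))
       (trans (∑-sumL es (λ u e → above u * edgeFlow c u e))
        (sumL-cong es (λ e →
          trans (∑-cong (λ u → distrib-indicator (above u) (c (proj₂ e) - c (proj₁ e)) (c (proj₁ e) - c (proj₂ e))
                                                  (δ u (proj₁ e)) (δ u (proj₂ e))))
           (trans (∑-+ (λ u → δ u (proj₁ e) * (above u * (c (proj₂ e) - c (proj₁ e))))
                       (λ u → δ u (proj₂ e) * (above u * (c (proj₁ e) - c (proj₂ e)))))
             (cong₂ _+_ (∑-δ (proj₁ e) (λ u → above u * (c (proj₂ e) - c (proj₁ e))))
                        (∑-δ (proj₂ e) (λ u → above u * (c (proj₁ e) - c (proj₂ e)))))))))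

    flowOut≤0 : ∀ e → flowOut e ≤ + 0
    flowOut≤0 (a , b) with t ℤP.≤? c a | t ℤP.≤? c b
    ... | yes _ | yes _ = ℤP.≤-reflexive (both-above (c a) (c b))
    ... | yes ta | no tb = ≤-cast (ℤP.i≤j⇒i-j≤0 (ℤP.<⇒≤ (ℤP.<-≤-trans (ℤP.≰⇒> tb) ta))) (sym (first-above (c a) (c b))) refl
    ... | no ta | yes tb = ≤-cast (ℤP.i≤j⇒i-j≤0 (ℤP.<⇒≤ (ℤP.<-≤-trans (ℤP.≰⇒> ta) tb))) (sym (second-above (c a) (c b))) refl
    ... | no _ | no _ = ℤP.≤-reflexive (none-above (c a) (c b))

    -- admissibility: Δc(u) ≥ −|D(u)| wherever D + Δc ≥ 0 or ≥ D
    ∑-above-Δ≥ : - ‖D‖ ≤ ∑ (λ u → above u * Δ c u)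
    ∑-above-Δ≥ = ≤-cast (∑-mono at) (∑-neg (λ u → + ℤ.∣ D u ∣)) refl
      where
      at : ∀ u → - (+ ℤ.∣ D u ∣) ≤ above u * Δ c u
      at u with t ℤP.≤? c u
      ... | no _ = ≤-cast (ℤP.neg-mono-≤ (∣∣-nonneg (D u))) refl (sym (ℤP.*-zeroˡ (Δ c u)))
      ... | yes _ with proj₂ (proj₂ adm) u
      ...   | inj₁ p = ≤-cast (ℤP.+-mono-≤ p (∣∣-lb (- D u))) (trans (ℤP.+-identityˡ _) (cong -_ (cong +_ (ℤP.∣-i∣≡∣i∣ (D u)))))
                              (trans (sym (Δ-from-fired (D u) (Δ c u))) (sym (ℤP.*-identityˡ (Δ c u))))
      ...   | inj₂ p = ≤-cast (ℤP.≤-trans (ℤP.neg-mono-≤ (∣∣-nonneg (D u))) (ℤP.i≤j⇒0≤j-i p)) refl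
                              (trans (sym (Δ-from-fired (D u) (Δ c u))) (sym (ℤP.*-identityˡ (Δ c u))))

    short-drop : ∀ {ca cb} → - ‖D‖ ≤ cb - ca → cb < t → ca < t + + W
    short-drop {ca} {cb} drop cb<t =
      subst (λ z → ca < t + z) +1+‖D‖≡W
        (+1≤⇒< (ℤP.0≤i-j⇒j≤i (≤-cast (ℤP.+-mono-≤ (ℤP.+-mono-≤ (ℤP.i≤j⇒0≤j-i drop) (ℤP.i≤j⇒0≤j-i (<⇒+1≤ cb<t)))
                                                   (ℤ.+≤+ (ℕ.z≤n {1})))
                                     refl (sym (gap-arith ca cb t ‖D‖)))))

    crossing-drop : ∀ {e} → e ∈ es → - ‖D‖ ≤ flowOut e
    crossing-drop mem = ℤP.≤-trans ∑-above-Δ≥ (≤-cast (sumL-≤-member flowOut≤0 mem) (sym ∑-above-Δ) refl)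

    gap : ∀ v → t ≤ c v → Σ (Fin N) λ u → t ≤ c u × c u < t + + W
    gap v tv with crossing c t (conn v q) tv (subst (_< t) (sym (proj₁ (proj₂ adm))) (+1≤⇒< {+ 0} 1≤t))
    ... | (a , b) , mem , inj₁ (ta , bt) =
          a , ta , short-drop (subst (- ‖D‖ ≤_) flow (crossing-drop mem)) bt
      where
      flow : flowOut (a , b) ≡ c b - c a
      flow = trans (cong₂ (λ x y → x * (c b - c a) + y * (c a - c b))
                     (𝟙-yes (t ℤP.≤? c a) ta) (𝟙-no (t ℤP.≤? c b) (λ p → ℤP.<-irrefl refl (ℤP.<-≤-trans bt p))))
                   (first-above (c a) (c b))
    ... | (a , b) , mem , inj₂ (tb , at) =
          b , tb , short-drop (subst (- ‖D‖ ≤_) flow (crossing-drop mem)) at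
      where
      flow : flowOut (a , b) ≡ c a - c b
      flow = trans (cong₂ (λ x y → x * (c b - c a) + y * (c a - c b))
                     (𝟙-no (t ℤP.≤? c a) (λ p → ℤP.<-irrefl refl (ℤP.<-≤-trans at p))) (𝟙-yes (t ℤP.≤? c b) tb))
                   (second-above (c a) (c b))

  private
    level-step : ∀ j w → j ℕ.* w ℕ.+ 1 ℕ.+ w ≡ (w ℕ.+ j ℕ.* w) ℕ.+ 1
    level-step = ℕSolver.solve-∀

  level : Fin N → ℤ
  level j = + (F.toℕ j ℕ.* W ℕ.+ 1)

  level≥1 : ∀ j → + 1 ≤ level j
  level≥1 j = ℤ.+≤+ (ℕP.m≤n+m 1 _)

  level≤NW : ∀ j → F.toℕ j ℕ.* W ℕ.+ 1 ℕ.≤ N ℕ.* W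
  level≤NW j = ℕP.≤-trans (ℕP.+-monoʳ-≤ (F.toℕ j ℕ.* W) {1} {W} (ℕ.s≤s ℕ.z≤n))
                 (ℕP.≤-trans (ℕP.≤-reflexive (ℕP.+-comm (F.toℕ j ℕ.* W) W))
                   (ℕP.*-mono-≤ {suc (F.toℕ j)} {N} {W} {W} (FP.toℕ<n j) (ℕP.≤-refl {W})))

  level-sep : ∀ j j' → F.toℕ j ℕ.< F.toℕ j' → level j + + W ≤ level j'
  level-sep j j' j<j' =
    ≤-cast (ℤ.+≤+ (ℕP.≤-trans (ℕP.≤-reflexive (level-step (F.toℕ j) W))
                    (ℕP.+-monoˡ-≤ 1 (ℕP.*-mono-≤ {suc (F.toℕ j)} {F.toℕ j'} {W} {W} j<j' (ℕP.≤-refl {W})))))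
           (ℤP.pos-+ (F.toℕ j ℕ.* W ℕ.+ 1) W) refl

  -- Admissible scripts are bounded by NW: otherwise the Gap lemma at the N
  -- levels gives N vertices with values in disjoint windows, all different
  -- from q (where c = 0); pigeonhole.
  admissible-bounded : ∀ c → Admissible c → ∀ v → c v ≤ + (N ℕ.* W)
  admissible-bounded c adm v₀ with c v₀ ℤP.≤? + (N ℕ.* W)
  ... | yes p = p
  ... | no np = ⊥-elim (distinct (FP.pigeonhole (ℕP.n<1+n N) witness))
    where
    reaches : ∀ j → level j ≤ c v₀
    reaches j = ℤP.≤-trans (ℤ.+≤+ (level≤NW j)) (ℤP.<⇒≤ (ℤP.≰⇒> np))
    module G j = Gap c adm (level j) (level≥1 j)
    witness : Fin (suc N) → Fin N
    witness zero = q
    witness (suc j) = proj₁ (G.gap j v₀ (reaches j))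
    lo : ∀ j → level j ≤ c (witness (suc j))
    lo j = proj₁ (proj₂ (G.gap j v₀ (reaches j)))
    hi : ∀ j → c (witness (suc j)) < level j + + W
    hi j = proj₂ (proj₂ (G.gap j v₀ (reaches j)))
    distinct : (Σ (Fin (suc N)) λ i → Σ (Fin (suc N)) λ i' → (i F.< i') × witness i ≡ witness i') → ⊥
    distinct (zero , suc j , _ , eq) =
      ℤP.<-irrefl refl (ℤP.<-≤-trans (+1≤⇒< {+ 0} (level≥1 j))
        (ℤP.≤-trans (lo j) (ℤP.≤-reflexive (trans (cong c (sym eq)) (proj₁ (proj₂ adm))))))
    distinct (suc j , suc j' , j<j' , eq) =
      ℤP.<-irrefl refl (ℤP.<-≤-trans (hi j)
        (ℤP.≤-trans (level-sep j j' (ℕP.≤-pred j<j')) (ℤP.≤-trans (lo j') (ℤP.≤-reflexive (cong c (sym eq))))))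

  ∑-bound : ℤ
  ∑-bound = + N * + (N ℕ.* W)

  admissible-∑-bounded : ∀ c → Admissible c → ∑ c ≤ ∑-bound
  admissible-∑-bounded c adm = ≤-cast (∑-mono (admissible-bounded c adm)) refl (∑-const {N} (+ (N ℕ.* W)))

  Reduced : Set
  Reduced = Σ (Fin N → ℤ) λ c → Σ (Fin N → ℤ) λ ρ → Admissible c × EdgeInjective ρ ×
            (∀ v → v ≢ q → fired c v ≤ ν[ ρ ] v) × ν[ ρ ] q ≡ - + 1

  private
    pred-suc : ∀ x → x + + 1 - + 1 ≡ x
    pred-suc = solve-∀
    no-in-edges : ∀ a b → a * + 0 + b * + 0 ≡ + 0
    no-in-edges = solve-∀
    fuel-step : ∀ f T s s' → f - (T - s') ≡ (s' - (s + + 1)) + ((+ 1 + f) - (T - s))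
    fuel-step = solve-∀

  fromAllBurnt : ∀ c → Admissible c → Burning.AllBurnt es loopless (fired c) q → Reduced
  fromAllBurnt c adm (ρ , inj , ρq , caught) =
    c , (λ x → + ρ x) , adm , All-map (λ ne eq → ne (inj _ _ (ℤP.+-injective eq))) loopless , below , q-source
    where
    below : ∀ v → v ≢ q → fired c v ≤ ν[ (λ x → + ρ x) ] v
    below v ne = ≤-cast (ℤP.+-monoˡ-≤ (- + 1) (<⇒+1≤ (caught v ne))) (pred-suc (fired c v)) refl
    nothing-before-q : ∀ x → ⟦ + ρ x < + ρ q ⟧ ≡ + 0
    nothing-before-q x = ⟦<⟧-no (λ p → ℕP.n≮0 (subst (ρ x ℕ.<_) ρq (ℤP.drop‿+<+ p)))
    q-source : ν[ (λ x → + ρ x) ] q ≡ - + 1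
    q-source = cong (_- + 1) (trans (sumL-cong es (λ e →
                 trans (cong₂ (λ x y → δ q (proj₁ e) * x + δ q (proj₂ e) * y)
                              (nothing-before-q (proj₂ e)) (nothing-before-q (proj₁ e)))
                       (no-in-edges (δ q (proj₁ e)) (δ q (proj₂ e)))))
                 (sumL-0 es))

  mutual
    reduce : ∀ fuel c → Admissible c → ∑-bound - ∑ c ≤ + fuel → Reduced
    reduce fuel c adm h with Burning.burnAll es loopless (fired c) q
    ... | inj₁ done = fromAllBurnt c adm done
    ... | inj₂ (ρ , k , st , (u , e) , stuck) =
          reduceNext fuel c adm h Fire.c⁺ Fire.admissible⁺ Fire.∑-increases
      where module Fire = FireUnburnt c adm ρ k st u e stuck

    reduceNext : ∀ fuel c → Admissible c → ∑-bound - ∑ c ≤ + fuel →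
                 ∀ c' → Admissible c' → ∑ c + + 1 ≤ ∑ c' → Reduced
    reduceNext zero c adm h c' adm' inc =
      ⊥-elim (ℤP.<-irrefl refl (ℤP.<-≤-trans (+1≤⇒< inc) (ℤP.≤-trans (admissible-∑-bounded c' adm') (ℤP.i-j≤0⇒i≤j h))))
    reduceNext (suc f) c adm h c' adm' inc =
      reduce f c' adm' (ℤP.0≤i-j⇒j≤i (≤-cast (ℤP.+-mono-≤ (ℤP.i≤j⇒0≤j-i inc) (ℤP.i≤j⇒0≤j-i (≤-cast h refl (ℤP.pos-+ 1 f))))
                                             refl (sym (fuel-step (+ f) ∑-bound (∑ c) (∑ c')))))

  zero-admissible : Admissible (λ _ → + 0)
  zero-admissible = (λ _ → ℤP.≤-refl) , refl ,
                    (λ v → inj₂ (ℤP.≤-reflexive (sym (trans (cong (λ z → D v + z) (Δ-0 v)) (ℤP.+-identityʳ (D v))))))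

  reduced : Reduced
  reduced = reduce ℤ.∣ ∑-bound ∣ (λ _ → + 0) zero-admissible
                   (≤-cast (∣∣-ub ∑-bound) (trans (sym (ℤP.+-identityʳ ∑-bound)) (cong (λ z → ∑-bound - z) (sym (∑-0 {N})))) refl)

neg : ℤ → ℕ
neg (+ _) = 0
neg -[1+ m ] = suc m

neg-0 : ∀ {x} → + 0 ≤ x → neg x ≡ 0
neg-0 {+ _} _ = refl

neg-anti : ∀ {x y} → x ≤ y → neg y ℕ.≤ neg x
neg-anti {+ _} {+ _} _ = ℕ.z≤n
neg-anti { -[1+ _ ]} {+ _} _ = ℕ.z≤n
neg-anti { -[1+ m ]} { -[1+ n ]} (ℤ.-≤- p) = ℕ.s≤s p

neg-pos : ∀ {x} → x < + 0 → 1 ℕ.≤ neg x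
neg-pos { -[1+ _ ]} _ = ℕ.s≤s ℕ.z≤n
neg-pos {+ _} (ℤ.+<+ ())

module EffectiveOrOrientation {N : ℕ} (es : List (Fin N × Fin N)) (loopless : All (λ e → proj₁ e ≢ proj₂ e) es)
                              (conn : Connected (graph N es [])) where
  open Laplacian es loopless
  open Orientations es loopless

  EffOrBelowOrient : Div N → Set
  EffOrBelowOrient D = LinSysNonempty H D
                     ⊎ Σ (Div N) λ ν → Σ (Div N) λ F → IsOrientDiv ν × Effective F × LinEquiv H D (ν ⊝ F)

  private
    fire-back : ∀ d l → d - (d + l) ≡ - l
    fire-back = solve-∀
    cancel-ν : ∀ d ν x → d - (ν - (ν - x)) ≡ d - x
    cancel-ν = solve-∀
    fire-diff : ∀ d l → (d + l) - d ≡ l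
    fire-diff = solve-∀
    pred-suc : ∀ x → x + + 1 - + 1 ≡ x
    pred-suc = solve-∀

  mutual
    reduceNeg : ∀ fuel (D : Div N) → ∑ℕ (λ v → neg (D v)) ℕ.≤ fuel → EffOrBelowOrient D
    reduceNeg fuel D h with FP.any? (λ v → D v ℤP.<? + 0)
    ... | no ¬neg = inj₁ (D , (λ v → ℤP.≮⇒≥ (λ p → ¬neg (v , p))) , ~-refl {D})
    ... | yes (q , Dq<0) = fromReduced fuel D h q Dq<0 (Reduction.reduced es loopless conn D q)

    fromReduced : ∀ fuel (D : Div N) → ∑ℕ (λ v → neg (D v)) ℕ.≤ fuel → ∀ q → D q < + 0 →
                  Reduction.Reduced es loopless conn D q → EffOrBelowOrient D
    fromReduced fuel D h q Dq<0 (c , ρ , adm , inj , below , q-source)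
      with Reduction.fired es loopless conn D q c q ℤP.<? + 0
    ... | yes Xq<0 = inj₂ (ν[ ρ ] , (λ v → ν[ ρ ] v - X v) , (ρ , inj , λ v → refl) , F≥0 , D~ν-F)
      where
      X : Div N
      X = Reduction.fired es loopless conn D q c
      F≥0 : ∀ v → + 0 ≤ ν[ ρ ] v - X v
      F≥0 v with v ≟ q
      ... | yes refl = ℤP.i≤j⇒0≤j-i (≤-cast (ℤP.+-monoˡ-≤ (- + 1) (<⇒+1≤ Xq<0)) (pred-suc (X v)) (sym q-source))
      ... | no ne = ℤP.i≤j⇒0≤j-i (below v ne)
      D~ν-F : LinEquiv H D (ν[ ρ ] ⊝ (λ v → ν[ ρ ] v - X v))
      D~ν-F = ~-by-Δ {D} {ν[ ρ ] ⊝ (λ v → ν[ ρ ] v - X v)} (λ v → - c v)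
                (λ w → trans (cancel-ν (D w) (ν[ ρ ] w) (X w)) (trans (fire-back (D w) (Δ c w)) (sym (Δ-neg c w))))
    ... | no Xq≮0 = recurse fuel D h q Dq<0 c adm (ℤP.≮⇒≥ Xq≮0)

    recurse : ∀ fuel (D : Div N) → ∑ℕ (λ v → neg (D v)) ℕ.≤ fuel → ∀ q → D q < + 0 →
              ∀ c → Reduction.Admissible es loopless conn D q c →
              + 0 ≤ Reduction.fired es loopless conn D q c q → EffOrBelowOrient D
    recurse zero D h q Dq<0 c adm Xq≥0 =
      ⊥-elim (ℕP.<-irrefl refl (ℕP.≤-trans (neg-pos Dq<0) (ℕP.≤-trans (∑ℕ-single (λ v → neg (D v)) q) h)))
    recurse (suc f) D h q Dq<0 c adm Xq≥0 = transport (reduceNeg f X smaller)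
      where
      X : Div N
      X = Reduction.fired es loopless conn D q c
      neg-mono : ∀ v → neg (X v) ℕ.≤ neg (D v)
      neg-mono v with proj₂ (proj₂ adm) v
      ... | inj₁ p = ℕP.≤-trans (ℕP.≤-reflexive (neg-0 p)) ℕ.z≤n
      ... | inj₂ p = neg-anti p
      smaller : ∑ℕ (λ v → neg (X v)) ℕ.≤ f
      smaller = ℕP.≤-pred (ℕP.<-≤-trans (∑ℕ-strict neg-mono q (subst (ℕ._< neg (D q)) (sym (neg-0 Xq≥0)) (neg-pos Dq<0))) h)
      X~D : LinEquiv H X D
      X~D = ~-by-Δ {X} {D} c (λ w → fire-diff (D w) (Δ c w))
      transport : EffOrBelowOrient X → EffOrBelowOrient D
      transport (inj₁ (E , E≥0 , E~X)) = inj₁ (E , E≥0 , ~-trans {E} E~X X~D)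
      transport (inj₂ (ν , F , ns , F≥0 , X~ν-F)) = inj₂ (ν , F , ns , F≥0 , ~-trans {D} (~-sym {X} {D} X~D) X~ν-F)

  effective-or-below-orientation : ∀ D → EffOrBelowOrient D
  effective-or-below-orientation D = reduceNeg _ D ℕP.≤-refl

-- The key formula is
--     r(D) + 1 = min { deg⁺(D' − ν) : D' ∼ D, ν = ν_ρ an orientation divisor },
-- from which the involution (D', ν) ↦ (K − D', K − ν) gives the theorem.

pos : ℤ → ℤ
pos (+ n) = + n
pos -[1+ _ ] = + 0

pos-nonneg : ∀ x → + 0 ≤ pos x
pos-nonneg (+ n) = ℤ.+≤+ ℕ.z≤n
pos-nonneg -[1+ _ ] = ℤP.≤-refl

pos-ge : ∀ x → x ≤ pos x
pos-ge (+ n) = ℤP.≤-refl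
pos-ge -[1+ _ ] = ℤ.-≤+

pos-id : ∀ {x} → + 0 ≤ x → pos x ≡ x
pos-id {+ _} _ = refl

pos-0 : ∀ {x} → x ≤ + 0 → pos x ≡ + 0
pos-0 { -[1+ _ ]} _ = refl
pos-0 {+ zero} _ = refl
pos-0 {+ suc n} (ℤ.+≤+ ())

pos-mono : ∀ {x y} → x ≤ y → pos x ≤ pos y
pos-mono {+ _} {+ _} p = p
pos-mono { -[1+ _ ]} {y} _ = pos-nonneg y
pos-mono {+ _} { -[1+ _ ]} ()

pos-neg : ∀ x → pos (- x) ≡ pos x - x
pos-neg (+ zero) = refl
pos-neg (+ suc n) = sym (ℤP.+-inverseʳ (+ suc n))
pos-neg -[1+ n ] = refl

pos-sub-le : ∀ {e f} → + 0 ≤ e → + 0 ≤ f → pos (e - f) ≤ e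
pos-sub-le {e} {f} e≥0 f≥0 = ℤP.≤-trans (pos-mono (ℤP.i-j≤i e f ⦃ ℤ.nonNegative f≥0 ⦄)) (ℤP.≤-reflexive (pos-id e≥0))

module RiemannRochLoopless {N : ℕ} (es : List (Fin N × Fin N)) (loopless : All (λ e → proj₁ e ≢ proj₂ e) es)
                           (conn : Connected (graph N es [])) (g : ℤ)
                           (deg-K : deg (Orientations.K es loopless) ≡ + 2 * g - + 2)
                           (edges-vertices : + length es - + N ≡ g - + 1) (q₀ : Fin N) where
  open Laplacian es loopless
  open Orientations es loopless
  open EffectiveOrOrientation es loopless conn

  deg-ν : ∀ {ν} → IsOrientDiv ν → deg ν ≡ g - + 1
  deg-ν (ρ , inj , eq) = trans (∑-cong eq) (trans (deg-orientDiv ρ inj) edges-vertices)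

  deg⁺ : Div N → ℤ
  deg⁺ X = ∑ (λ v → pos (X v))

  deg⁺-nonneg : ∀ X → + 0 ≤ deg⁺ X
  deg⁺-nonneg X = ∑-nonneg (λ v → pos-nonneg (X v))

  deg⁺-flip : ∀ A B → deg⁺ (B ⊝ A) ≡ deg⁺ (A ⊝ B) - (deg A - deg B)
  deg⁺-flip A B = trans (∑-cong (λ v → trans (cong pos (diff-sym (B v) (A v))) (pos-neg (A v - B v))))
                   (trans (∑-- (λ v → pos (A v - B v)) (λ v → A v - B v)) (cong (λ z → deg⁺ (A ⊝ B) - z) (∑-- A B)))
    where diff-sym : ∀ b a → b - a ≡ - (a - b)
          diff-sym = solve-∀

  Witness : Div N → ℤ → Set
  Witness D m = Σ (Div N) λ D' → Σ (Div N) λ ν → LinEquiv H D' D × IsOrientDiv ν × deg⁺ (D' ⊝ ν) ≤ m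

  -- m is the minimum of deg⁺(D' − ν); attainment is only known up to
  -- double negation, which suffices for the integer equalities below
  IsMinDeg⁺ : Div N → ℤ → Set
  IsMinDeg⁺ D m = (∀ D' ν → LinEquiv H D' D → IsOrientDiv ν → m ≤ deg⁺ (D' ⊝ ν)) × ¬ ¬ Witness D m

  private
    fill-degree : ∀ p x → p + (x - p) ≡ x
    fill-degree = solve-∀
    G-diff : ∀ f n d e → (f + ((n - d) + e)) - n ≡ f - (d - e)
    G-diff = solve-∀
    same-shift : ∀ d d' e → (d - e) - (d' - e) ≡ d - d'
    same-shift = solve-∀
    G-extra : ∀ e d n → e - (d - n) ≡ (n - d) + e
    G-extra = solve-∀

  -- If |D − E| ≠ ∅ for all effective E of degree k, every deg⁺(D' − ν) > k:
  -- otherwise E = (D' − ν)⁺ + (k − deg⁺(D' − ν))·q₀ would give F ≥ 0 with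
  -- F ∼ D' − E, and then F + ν − D' + E ≥ 0 would be equivalent to ν.
  good⇒deg⁺> : ∀ {D k} → Good H D k → ∀ D' ν → LinEquiv H D' D → IsOrientDiv ν → + suc k ≤ deg⁺ (D' ⊝ ν)
  good⇒deg⁺> {D} {k} good D' ν D'~D ns with + suc k ℤP.≤? deg⁺ (D' ⊝ ν)
  ... | yes p = p
  ... | no np = ⊥-elim (orientDiv-not-effective q₀ ns (G , G≥0 , G~ν))
    where
    small : deg⁺ (D' ⊝ ν) ≤ + k
    small = ℤP.i<j⇒i≤pred[j] (ℤP.≰⇒> np)
    r : ℤ
    r = + k - deg⁺ (D' ⊝ ν)
    E : Div N
    E v = pos (D' v - ν v) + δ v q₀ * r
    E≥pos : ∀ v → pos (D' v - ν v) ≤ E v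
    E≥pos v = ≤-cast (ℤP.+-mono-≤ (ℤP.≤-refl {pos (D' v - ν v)}) (0≤* (δ-nonneg v q₀) (ℤP.i≤j⇒0≤j-i small)))
                     (ℤP.+-identityʳ _) refl
    E≥0 : Effective E
    E≥0 v = ℤP.≤-trans (pos-nonneg _) (E≥pos v)
    deg-E : deg E ≡ + k
    deg-E = trans (∑-+ (λ v → pos (D' v - ν v)) (λ v → δ v q₀ * r))
             (trans (cong (λ z → deg⁺ (D' ⊝ ν) + z) (∑-δ q₀ (λ _ → r))) (fill-degree (deg⁺ (D' ⊝ ν)) (+ k)))
    F : Div N
    F = proj₁ (good E E≥0 deg-E)
    F~D'-E : LinEquiv H F (D' ⊝ E)
    F~D'-E = ~-trans {F} {D ⊝ E} {D' ⊝ E} (proj₂ (proj₂ (good E E≥0 deg-E)))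
               (~-diff {D} {D'} {D ⊝ E} {D' ⊝ E} (~-sym {D'} {D} D'~D) (λ w → sym (same-shift (D w) (D' w) (E w))))
    G : Div N
    G v = F v + ((ν v - D' v) + E v)
    G≥0 : Effective G
    G≥0 v = ℤP.+-mono-≤ (proj₁ (proj₂ (good E E≥0 deg-E)) v)
              (≤-cast (ℤP.i≤j⇒0≤j-i (ℤP.≤-trans (pos-ge (D' v - ν v)) (E≥pos v))) refl (G-extra (E v) (D' v) (ν v)))
    G~ν : LinEquiv H G ν
    G~ν = ~-diff {F} {D' ⊝ E} {G} {ν} F~D'-E (λ w → sym (G-diff (F w) (ν w) (D' w) (E w)))

  private
    witness-diff : ∀ n f e → ((n - f) + e) - n ≡ e - f
    witness-diff = solve-∀
    witness-~ : ∀ n f d e → ((n - f) + e) - d ≡ (n - f) - (d - e)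
    witness-~ = solve-∀
    below-diff : ∀ n f → (n - f) - n ≡ - f
    below-diff = solve-∀

  below-witness : ∀ {D ν F} → IsOrientDiv ν → Effective F → LinEquiv H D (ν ⊝ F) → Witness D (+ 0)
  below-witness {D} {ν} {F} ns F≥0 D~ν-F =
    ν ⊝ F , ν , ~-sym {D} {ν ⊝ F} D~ν-F , ns ,
    ℤP.≤-reflexive (trans (∑-cong (λ v → trans (cong pos (below-diff (ν v) (F v))) (pos-0 (ℤP.neg-mono-≤ (F≥0 v)))))
                          (∑-0 {N}))

  -- If |D − E| = ∅ for some effective E of degree k, some deg⁺(D' − ν) ≤ k:
  -- by (N2), D − E ∼ ν − F, and D' = ν − F + E has deg⁺(D' − ν) ≤ deg E.
  ¬good⇒witness : ∀ {D} k → ¬ Good H D k → ¬ ¬ Witness D (+ k)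
  ¬good⇒witness {D} k ¬good no-witness = ¬good good
    where
    good : Good H D k
    good E E≥0 deg-E with effective-or-below-orientation (D ⊝ E)
    ... | inj₁ nonempty = nonempty
    ... | inj₂ (ν , F , ns , F≥0 , D-E~ν-F) = ⊥-elim (no-witness (D' , ν , D'~D , ns , bound))
      where
      D' : Div N
      D' v = (ν v - F v) + E v
      D'~D : LinEquiv H D' D
      D'~D = ~-diff {ν ⊝ F} {D ⊝ E} {D'} {D} (~-sym {D ⊝ E} {ν ⊝ F} D-E~ν-F) (λ w → sym (witness-~ (ν w) (F w) (D w) (E w)))
      bound : deg⁺ (D' ⊝ ν) ≤ + k
      bound = ℤP.≤-trans (∑-mono (λ v → ℤP.≤-trans (ℤP.≤-reflexive (cong pos (witness-diff (ν v) (F v) (E v))))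
                                                    (pos-sub-le (E≥0 v) (F≥0 v))))
                         (ℤP.≤-reflexive deg-E)

  empty⇒min0 : ∀ {D} → ¬ LinSysNonempty H D → IsMinDeg⁺ D (+ 0)
  empty⇒min0 {D} empty = (λ D' ν _ _ → deg⁺-nonneg (D' ⊝ ν)) , λ no-witness → witness no-witness
    where
    witness : ¬ ¬ Witness D (+ 0)
    witness no-witness with effective-or-below-orientation D
    ... | inj₁ nonempty = empty nonempty
    ... | inj₂ (ν , F , ns , F≥0 , D~ν-F) = no-witness (below-witness ns F≥0 D~ν-F)

  rank+1-is-min : ∀ {D r} → IsRank H D r → IsMinDeg⁺ D (r + + 1)
  rank+1-is-min (inj₁ (refl , empty)) = empty⇒min0 empty
  rank+1-is-min {D} (inj₂ (k , refl , _ , good , maximal)) =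
    (λ D' ν D'~D ns → ≤-cast (good⇒deg⁺> good D' ν D'~D ns) suc-k refl) ,
    ¬¬-map (subst (Witness D) suc-k) (¬good⇒witness (suc k) (λ gd → ℕP.<-irrefl refl (maximal (suc k) gd)))
    where
    suc-k : + suc k ≡ + k + + 1
    suc-k = trans (cong +_ (ℕP.+-comm 1 k)) (ℤP.pos-+ k 1)

  private
    dual-~ : ∀ a b d' k → k ≡ a + b → (k - d') - b ≡ a - d'
    dual-~ a b d' k refl = cancel a b d'
      where cancel : ∀ a b d' → ((a + b) - d') - b ≡ a - d'
            cancel = solve-∀
    dual-diff : ∀ k d' n → (k - d') - (k - n) ≡ n - d'
    dual-diff = solve-∀

  -- Duality: if A + B = K, then min_B ≤ min_A − (deg A − (g − 1)).
  -- A witness (D', ν) for A gives the pair (K − D', K − ν) for B.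
  duality : ∀ {A B m m'} → (∀ v → K v ≡ A v + B v) → IsMinDeg⁺ A m → IsMinDeg⁺ B m' →
            m' ≤ m - (deg A - (g - + 1))
  duality {A} {B} {m} {m'} A+B (_ , witness) (minimal , _) =
    decidable-stable (m' ℤP.≤? _) (¬¬-map bound witness)
    where
    bound : Witness A m → m' ≤ m - (deg A - (g - + 1))
    bound (D' , ν , D'~A , ns , D'-ν≤m) =
      ℤP.≤-trans (minimal (K ⊝ D') (K ⊝ ν) K-D'~B (reverse-orientation ns))
        (≤-cast (ℤP.+-monoˡ-≤ (- (deg D' - deg ν)) D'-ν≤m)
                (sym (trans (∑-cong (λ v → cong pos (dual-diff (K v) (D' v) (ν v)))) (deg⁺-flip D' ν)))
                (cong (λ z → m - z) (cong₂ _-_ (deg-~ {D'} {A} D'~A) (deg-ν ns))))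
      where
      K-D'~B : LinEquiv H (K ⊝ D') B
      K-D'~B = ~-diff {A} {D'} {K ⊝ D'} {B} (~-sym {D'} {A} D'~A) (λ w → sym (dual-~ (A w) (B w) (D' w) (K w) (A+B w)))

  private
    K-split : ∀ k d → k ≡ d + (k - d)
    K-split = solve-∀
    K-split' : ∀ k d → k ≡ (k - d) + d
    K-split' = solve-∀
    upper-arith : ∀ m m' dD g → (m' - (((+ 2 * g - + 2) - dD) - (g - + 1))) - m ≡ (dD - g + + 1) - (m - m')
    upper-arith = solve-∀
    lower-arith : ∀ m m' dD g → (m - (dD - (g - + 1))) - m' ≡ (m - m') - (dD - g + + 1)
    lower-arith = solve-∀

  min-RR : ∀ {D m m'} → IsMinDeg⁺ D m → IsMinDeg⁺ (K ⊝ D) m' → m - m' ≡ deg D - g + + 1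
  min-RR {D} {m} {m'} min-D min-K-D = ℤP.≤-antisym upper lower
    where
    A : m' ≤ m - (deg D - (g - + 1))
    A = duality (λ v → K-split (K v) (D v)) min-D min-K-D
    B : m ≤ m' - (((+ 2 * g - + 2) - deg D) - (g - + 1))
    B = subst (λ z → m ≤ m' - (z - (g - + 1))) (trans (∑-- K D) (cong (_- deg D) deg-K))
              (duality (λ v → K-split' (K v) (D v)) min-K-D min-D)
    upper : m - m' ≤ deg D - g + + 1
    upper = ℤP.0≤i-j⇒j≤i (≤-cast (ℤP.i≤j⇒0≤j-i B) refl (upper-arith m m' (deg D) g))
    lower : deg D - g + + 1 ≤ m - m'
    lower = ℤP.0≤i-j⇒j≤i (≤-cast (ℤP.i≤j⇒0≤j-i A) refl (lower-arith m m' (deg D) g))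

  private
    zero-diff : ∀ k d' n → (k - k) - d' ≡ (n - d') - n
    zero-diff = solve-∀
    zero-minus-q : ∀ k x → (k - k) - x ≡ - (x * + 1)
    zero-minus-q = solve-∀
    shift-q : ∀ n f k x → (n - f) - ((k - k) - x) ≡ ((n - f) + x) - (k - k)
    shift-q = solve-∀

  0≰-1 : ¬ (+ 0 ≤ - + 1)
  0≰-1 ()

  -- r(0) = 0, i.e. the minimum for the zero divisor K − K is 1
  min-zero : IsMinDeg⁺ (K ⊝ K) (+ 1)
  min-zero = minimal , witness
    where
    minimal : ∀ D' ν → LinEquiv H D' (K ⊝ K) → IsOrientDiv ν → + 1 ≤ deg⁺ (D' ⊝ ν)
    minimal D' ν D'~0 ns with + 1 ℤP.≤? deg⁺ (D' ⊝ ν)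
    ... | yes p = p
    ... | no np = ⊥-elim (orientDiv-not-effective q₀ ns ((ν ⊝ D') , ν-D'≥0 , ν-D'~ν))
      where
      deg⁺≤0 : deg⁺ (D' ⊝ ν) ≤ + 0
      deg⁺≤0 = ℤP.i<j⇒i≤pred[j] (ℤP.≰⇒> np)
      ν-D'≥0 : Effective (ν ⊝ D')
      ν-D'≥0 v = ℤP.i≤j⇒0≤j-i (ℤP.i-j≤0⇒i≤j {D' v} {ν v}
                   (ℤP.≤-trans (pos-ge _) (ℤP.≤-trans (∑-single (λ u → pos-nonneg ((D' ⊝ ν) u)) v) deg⁺≤0)))
      ν-D'~ν : LinEquiv H (ν ⊝ D') ν
      ν-D'~ν = ~-diff {K ⊝ K} {D'} {ν ⊝ D'} {ν} (~-sym {D'} {K ⊝ K} D'~0) (λ w → zero-diff (K w) (D' w) (ν w))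
    -q₀ : Div N
    -q₀ v = (K v - K v) - δ v q₀
    witness : ¬ ¬ Witness (K ⊝ K) (+ 1)
    witness no-witness with effective-or-below-orientation -q₀
    ... | inj₁ (E , E≥0 , E~-q₀) = 0≰-1 (≤-cast (∑-nonneg E≥0) refl deg-E)
      where
      deg-E : deg E ≡ - + 1
      deg-E = trans (deg-~ {E} { -q₀} E~-q₀)
                (trans (∑-cong (λ v → zero-minus-q (K v) (δ v q₀)))
                  (trans (∑-neg (λ v → δ v q₀ * + 1)) (cong -_ (∑-δ q₀ (λ _ → + 1)))))
    ... | inj₂ (ν , F , ns , F≥0 , -q₀~ν-F) = no-witness (D' , ν , D'~0 , ns , bound)
      where
      D' : Div N
      D' v = (ν v - F v) + δ v q₀
      D'~0 : LinEquiv H D' (K ⊝ K)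
      D'~0 = ~-diff {ν ⊝ F} { -q₀} {D'} {K ⊝ K} (~-sym { -q₀} {ν ⊝ F} -q₀~ν-F) (λ w → shift-q (ν w) (F w) (K w) (δ w q₀))
      bound : deg⁺ (D' ⊝ ν) ≤ + 1
      bound = ℤP.≤-trans (∑-mono (λ v → ℤP.≤-trans (ℤP.≤-reflexive (cong pos (witness-diff (ν v) (F v) (δ v q₀))))
                                                    (pos-sub-le (δ-nonneg v q₀) (F≥0 v))))
                         (ℤP.≤-reflexive (∑δ q₀))

  -- deg D ≥ 2g − 1 forces deg(K − D) < 0, hence |K − D| = ∅
  large-degree⇒min0 : ∀ {D} → + 2 * g - + 1 ≤ deg D → IsMinDeg⁺ (K ⊝ D) (+ 0)
  large-degree⇒min0 {D} big = empty⇒min0 empty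
    where
    negative : ∀ t d → ((t - + 2) - d) + (d - (t - + 1)) ≡ - + 1
    negative = solve-∀
    empty : ¬ LinSysNonempty H (K ⊝ D)
    empty (E , E≥0 , E~K-D) =
      0≰-1 (≤-cast (ℤP.+-mono-≤ (≤-cast (∑-nonneg E≥0) refl deg-E) (ℤP.i≤j⇒0≤j-i big))
                   refl (negative (+ 2 * g) (deg D)))
      where
      deg-E : deg E ≡ (+ 2 * g - + 2) - deg D
      deg-E = trans (deg-~ {E} {K ⊝ D} E~K-D) (trans (∑-- K D) (cong (_- deg D) deg-K))

  private
    shift-ranks : ∀ r r' → (r + + 1) - (r' + + 1) ≡ r - r'
    shift-ranks = solve-∀
    unshift : ∀ r → r ≡ (r + + 1) - + 1
    unshift = solve-∀
    canonical-rank : ∀ g → (+ 2 * g - + 2) - g + + 1 ≡ g - + 1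
    canonical-rank = solve-∀
    riemann : ∀ d g → d - g + + 1 - + 1 ≡ d - g
    riemann = solve-∀

  riemann-roch : ∀ D r r' → IsRank H D r → IsRank H (K ⊝ D) r' → r - r' ≡ deg D - g + + 1
  riemann-roch D r r' rD rK-D = trans (sym (shift-ranks r r')) (min-RR {D} (rank+1-is-min rD) (rank+1-is-min rK-D))

  rank-K : ∀ r → IsRank H K r → r ≡ g - + 1
  rank-K r rK = trans (unshift r) (trans (min-RR {K} (rank+1-is-min rK) min-zero)
                                         (trans (cong (λ z → z - g + + 1) deg-K) (canonical-rank g)))

  riemann-large : ∀ D → + 2 * g - + 1 ≤ deg D → ∀ r → IsRank H D r → r ≡ deg D - g
  riemann-large D big r rD =
    trans (unshift r) (trans (cong (_- + 1) (sym (ℤP.+-identityʳ (r + + 1))))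
      (trans (cong (_- + 1) (min-RR {D} (rank+1-is-min rD) (large-degree⇒min0 big))) (riemann (deg D) g)))

Reach-trans : ∀ {G : Graph} {x y z} → Reach G x y → Reach G y z → Reach G x z
Reach-trans here s = s
Reach-trans (stepF m r) s = stepF m (Reach-trans r s)
Reach-trans (stepB m r) s = stepB m (Reach-trans r s)

Reach-sym : ∀ {G : Graph} {x y} → Reach G x y → Reach G y x
Reach-sym here = here
Reach-sym (stepF m r) = Reach-trans (Reach-sym r) (stepB m here)
Reach-sym (stepB m r) = Reach-trans (Reach-sym r) (stepF m here)

↑ˡ≢↑ʳ : ∀ {k L} (v : Fin k) (j : Fin L) → v ↑ˡ L ≢ k ↑ʳ j
↑ˡ≢↑ʳ {k} {L} v j eq with trans (sym (FP.splitAt-↑ˡ k v L)) (trans (cong (splitAt k) eq) (FP.splitAt-↑ʳ k L j))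
... | ()

δ-↑ˡ : ∀ {k L} (v a : Fin k) → δ (v ↑ˡ L) (a ↑ˡ L) ≡ δ v a
δ-↑ˡ {k} {L} v a = cong b2z (does-≡ (v ↑ˡ L ≟ a ↑ˡ L) (v ≟ a) (FP.↑ˡ-injective L v a) (cong (_↑ˡ L)))

δ-↑ʳ : ∀ {k L} (j i : Fin L) → δ (k ↑ʳ j) (k ↑ʳ i) ≡ δ j i
δ-↑ʳ {k} {L} j i = cong b2z (does-≡ (k ↑ʳ j ≟ k ↑ʳ i) (j ≟ i) (FP.↑ʳ-injective k j i) (cong (k ↑ʳ_)))

δ-old-new : ∀ {k L} (v : Fin k) (j : Fin L) → δ (v ↑ˡ L) (k ↑ʳ j) ≡ + 0
δ-old-new v j = δ-≢ (↑ˡ≢↑ʳ v j)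

δ-new-old : ∀ {k L} (v : Fin k) (j : Fin L) → δ (k ↑ʳ j) (v ↑ˡ L) ≡ + 0
δ-new-old v j = δ-≢ (λ eq → ↑ˡ≢↑ʳ v j (sym eq))

old-or-new : ∀ k L (x : Fin (k ℕ.+ L)) → (Σ (Fin k) λ v → v ↑ˡ L ≡ x) ⊎ (Σ (Fin L) λ j → k ↑ʳ j ≡ x)
old-or-new k L x with splitAt k x in eq
... | inj₁ v = inj₁ (v , FP.splitAt⁻¹-↑ˡ eq)
... | inj₂ j = inj₂ (j , FP.splitAt⁻¹-↑ʳ eq)

module Subdivision (k : ℕ) (es : List (Fin k × Fin k)) (ls : List (Fin k)) where
  G : Graph
  G = graph k es ls

  L : ℕ
  L = length ls

  oldEdge : Fin k × Fin k → Fin (k ℕ.+ L) × Fin (k ℕ.+ L)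
  oldEdge e = (proj₁ e ↑ˡ L , proj₂ e ↑ˡ L)

  loopEdge : Fin L → Fin (k ℕ.+ L) × Fin (k ℕ.+ L)
  loopEdge i = (lookup ls i ↑ˡ L , k ↑ʳ i)

  loopEdges : Fin L → List (Fin (k ℕ.+ L) × Fin (k ℕ.+ L))
  loopEdges i = loopEdge i ∷ loopEdge i ∷ []

  Ê : List (Fin (k ℕ.+ L) × Fin (k ℕ.+ L))
  Ê = map oldEdge es ++ concat (map loopEdges (allFin L))

  -- hat G is, by definition, graph (k + L) Ê []
  Ĝ : Graph
  Ĝ = graph (k ℕ.+ L) Ê []

  sumL-Ê : ∀ (φ : Fin (k ℕ.+ L) × Fin (k ℕ.+ L) → ℤ) →
           sumL (map φ Ê) ≡ sumL (map (λ e → φ (oldEdge e)) es) + ∑ (λ i → φ (loopEdge i) + (φ (loopEdge i) + + 0))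
  sumL-Ê φ = trans (sumL-++ φ (map oldEdge es) (concat (map loopEdges (allFin L))))
               (cong₂ _+_ (sumL-map φ oldEdge es)
                 (trans (sumL-concat φ (map loopEdges (allFin L)))
                   (trans (sumL-map (λ xs → sumL (map φ xs)) loopEdges (allFin L))
                     (sumL-tabulate (λ i → i) (λ i → sumL (map φ (loopEdges i)))))))

  Ĝ-loopless : NonLoopEdges G → All (λ e → proj₁ e ≢ proj₂ e) Ê
  Ĝ-loopless nle = AllP.++⁺ (AllP.map⁺ (All-map (λ ne eq → ne (FP.↑ˡ-injective L _ _ eq)) nle))
                            (AllP.concat⁺ (AllP.map⁺ (AllP.tabulate⁺ loops-ok)))
    where
    loops-ok : ∀ i → All (λ e → proj₁ e ≢ proj₂ e) (loopEdges i)
    loops-ok i = ↑ˡ≢↑ʳ (lookup ls i) i ∷ ↑ˡ≢↑ʳ (lookup ls i) i ∷ []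

  lift-walk : ∀ {a b} → Reach G a b → Reach Ĝ (a ↑ˡ L) (b ↑ˡ L)
  lift-walk here = here
  lift-walk (stepF m r) = stepF (∈-++⁺ˡ (∈-map⁺ oldEdge m)) (lift-walk r)
  lift-walk (stepB m r) = stepB (∈-++⁺ˡ (∈-map⁺ oldEdge m)) (lift-walk r)

  to-old-vertex : ∀ x → Σ (Fin k) λ v → Reach Ĝ x (v ↑ˡ L)
  to-old-vertex x with old-or-new k L x
  ... | inj₁ (v , refl) = v , here
  ... | inj₂ (j , refl) = lookup ls j ,
        stepB (∈-++⁺ʳ (map oldEdge es) (∈-concat⁺′ (here refl) (∈-map⁺ loopEdges (∈-allFin j)))) here

  Ĝ-connected : Connected G → Connected Ĝ
  Ĝ-connected conn x y with to-old-vertex x | to-old-vertex y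
  ... | v , x→v | w , y→w = Reach-trans x→v (Reach-trans (lift-walk (conn v w)) (Reach-sym y→w))

  σ*-old : ∀ (D : Div k) v → σ* G D (v ↑ˡ L) ≡ D v
  σ*-old D v rewrite FP.splitAt-↑ˡ k v L = refl

  σ*-new : ∀ (D : Div k) j → σ* G D (k ↑ʳ j) ≡ + 0
  σ*-new D j rewrite FP.splitAt-↑ʳ k L j = refl

  σ*-⊝ : ∀ (A B : Div k) x → σ* G (A ⊝ B) x ≡ σ* G A x - σ* G B x
  σ*-⊝ A B x with splitAt k x
  ... | inj₁ _ = refl
  ... | inj₂ _ = refl

  deg-σ* : ∀ (D : Div k) → deg (σ* G D) ≡ deg D
  deg-σ* D = trans (∑-split k L (σ* G D))
               (trans (cong₂ _+_ (∑-cong (σ*-old D)) (trans (∑-cong (σ*-new D)) (∑-0 {L})))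
                      (ℤP.+-identityʳ (deg D)))

  loop-∑ : ∀ v → loop G v ≡ ∑ (λ i → δ v (lookup ls i))
  loop-∑ v = trans (cong (λ z → sumL (map (λ u → δ v u) z)) (sym (LP.tabulate-lookup ls)))
                   (sumL-tabulate (lookup ls) (λ u → δ v u))

  private
    ends-old : ∀ x y → x * + 1 + y * + 1 ≡ x + y
    ends-old = solve-∀
    ends-loop : ∀ d → (d * + 1 + + 0 * + 1) + ((d * + 1 + + 0 * + 1) + + 0) ≡ + 2 * d
    ends-loop = solve-∀
    ends-new : ∀ d → (+ 0 * + 1 + d * + 1) + ((+ 0 * + 1 + d * + 1) + + 0) ≡ + 2 * d
    ends-new = solve-∀
    deg-K#-arith : ∀ E L k → (+ 2 * E + + 2 * L) - k * + 2 ≡ + 2 * ((E + L) - k + + 1) - + 2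
    deg-K#-arith = solve-∀
    genus-arith : ∀ E L k → (E + L * + 2) - (k + L) ≡ ((E + L) - k + + 1) - + 1
    genus-arith = solve-∀

  -- valencies in Ĝ: an old vertex keeps val_G (a loop counts twice, as its
  -- double edge does); a new vertex has valency 2
  module _ (Ê-loopless : All (λ e → proj₁ e ≢ proj₂ e) Ê) where
    open Orientations Ê Ê-loopless using (K)

    K̂-old : ∀ v → K (v ↑ˡ L) ≡ val G v - + 2
    K̂-old v = cong (_- + 2)
      (trans (sumL-Ê φ)
        (cong₂ _+_
          (sumL-cong es (λ e → trans (cong₂ (λ x y → x * + 1 + y * + 1) (δ-↑ˡ v (proj₁ e)) (δ-↑ˡ v (proj₂ e)))
                                     (ends-old (δ v (proj₁ e)) (δ v (proj₂ e)))))
          (trans (∑-cong (λ i → trans (cong (λ z → z + (z + + 0))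
                                        (cong₂ (λ x y → x * + 1 + y * + 1) (δ-↑ˡ v (lookup ls i)) (δ-old-new v i)))
                                      (ends-loop (δ v (lookup ls i)))))
            (trans (∑-* (+ 2) (λ i → δ v (lookup ls i))) (cong (+ 2 *_) (sym (loop-∑ v)))))))
      where
      φ : Fin (k ℕ.+ L) × Fin (k ℕ.+ L) → ℤ
      φ e = δ (v ↑ˡ L) (proj₁ e) * + 1 + δ (v ↑ˡ L) (proj₂ e) * + 1

    K̂-new : ∀ j → K (k ↑ʳ j) ≡ + 0
    K̂-new j = cong (_- + 2)
      (trans (sumL-Ê φ)
        (cong₂ _+_
          (trans (sumL-cong es (λ e → cong₂ (λ x y → x * + 1 + y * + 1) (δ-new-old (proj₁ e) j) (δ-new-old (proj₂ e) j)))
                 (sumL-0 es))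
          (trans (∑-cong (λ i → trans (cong (λ z → z + (z + + 0))
                                        (cong₂ (λ x y → x * + 1 + y * + 1) (δ-new-old (lookup ls i) j) (δ-↑ʳ {k} j i)))
                                      (ends-new (δ j i))))
            (trans (∑-* (+ 2) (λ i → δ j i)) (cong (+ 2 *_) (∑δ' j))))))
      where
      φ : Fin (k ℕ.+ L) × Fin (k ℕ.+ L) → ℤ
      φ e = δ (k ↑ʳ j) (proj₁ e) * + 1 + δ (k ↑ʳ j) (proj₂ e) * + 1

    K̂≡σ*K# : ∀ x → K x ≡ σ* G (K# G) x
    K̂≡σ*K# x with old-or-new k L x
    ... | inj₁ (v , refl) = trans (K̂-old v) (sym (σ*-old (K# G) v))
    ... | inj₂ (j , refl) = trans (K̂-new j) (sym (σ*-new (K# G) j))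

  -- deg K# = 2g − 2: each edge has two ends, each loop is counted twice
  deg-K# : deg (K# G) ≡ + 2 * genus G - + 2
  deg-K# =
    trans (∑-- (val G) (λ _ → + 2))
     (trans (cong₂ _-_ (trans (∑-+ (λ v → sumL (map (ends v) es)) (λ v → + 2 * loop G v))
                          (cong₂ _+_ edge-ends loop-ends))
                       (∑-const {k} (+ 2)))
       (deg-K#-arith (+ length es) (+ L) (+ k)))
    where
    edge-ends : ∑ (λ v → sumL (map (ends v) es)) ≡ + 2 * + length es
    edge-ends = trans (∑-sumL es (λ v e → ends v e))
                 (trans (sumL-cong es (λ e → trans (∑-+ (λ v → δ v (proj₁ e)) (λ v → δ v (proj₂ e)))
                                                   (trans (cong₂ _+_ (∑δ (proj₁ e)) (∑δ (proj₂ e)))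
                                                          (sym (ℤP.*-identityʳ (+ 2))))))
                   (trans (sumL-* (+ 2) (λ _ → + 1) es) (cong (+ 2 *_) (sumL-1 es))))
    loop-ends : ∑ (λ v → + 2 * loop G v) ≡ + 2 * + L
    loop-ends = trans (∑-* (+ 2) (loop G))
                 (cong (+ 2 *_) (trans (∑-sumL ls (λ v u → δ v u))
                                  (trans (sumL-cong ls ∑δ) (sumL-1 ls))))

  Ĝ-edges-vertices : + length Ê - + (k ℕ.+ L) ≡ genus G - + 1
  Ĝ-edges-vertices =
    trans (cong₂ _-_ |Ê| (ℤP.pos-+ k L)) (genus-arith (+ length es) (+ L) (+ k))
    where
    |Ê| : + length Ê ≡ + length es + + L * + 2
    |Ê| = trans (sym (sumL-1 Ê)) (trans (sumL-Ê (λ _ → + 1)) (cong₂ _+_ (sumL-1 es) (∑-const {L} (+ 2))))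

nonempty-cong : ∀ {G : Graph} {A B : Div (n G)} → (∀ x → A x ≡ B x) → LinSysNonempty G A → LinSysNonempty G B
nonempty-cong eq (E , E≥0 , c , h) = E , E≥0 , c , λ w → trans (cong (λ z → E w - z) (sym (eq w))) (h w)

good-cong : ∀ {G : Graph} {A B : Div (n G)} {m} → (∀ x → A x ≡ B x) → Good G A m → Good G B m
good-cong {G} {A} {B} eq good E E≥0 d = nonempty-cong {G} {A ⊝ E} {B ⊝ E} (λ x → cong (_- E x) (eq x)) (good E E≥0 d)

rank-cong : ∀ {G : Graph} {A B : Div (n G)} {r} → (∀ x → A x ≡ B x) → IsRank G A r → IsRank G B r
rank-cong {G} {A} {B} eq (inj₁ (r≡-1 , empty)) = inj₁ (r≡-1 , λ x → empty (nonempty-cong {G} {B} {A} (λ y → sym (eq y)) x))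
rank-cong {G} {A} {B} eq (inj₂ (k , r≡k , nonempty , good , maximal)) =
  inj₂ (k , r≡k , nonempty-cong {G} {A} {B} eq nonempty , good-cong {G} {A} {B} eq good ,
        λ m gd → maximal m (good-cong {G} {B} {A} (λ y → sym (eq y)) gd))

-- On the graph with no vertices every k qualifies in the definition of
-- rank (there is no effective divisor of positive degree), so no divisor
-- has a rank and the statements about ranks hold vacuously.
no-rank-on-empty : ∀ {A : Div 0} {r} → ¬ IsRank (graph 0 [] []) A r
no-rank-on-empty (inj₁ (_ , empty)) = empty ((λ ()) , (λ ()) , (λ ()) , (λ ()))
no-rank-on-empty (inj₂ (k , _ , _ , _ , maximal)) = ℕP.<-irrefl refl (maximal (suc k) (λ E E≥0 ()))

theorem3p6 : (G : Graph) → Connected G → NonLoopEdges G → (D : Div (n G)) →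
    (∀ r r' → IsRank# G D r → IsRank# G (K# G ⊝ D) r' →
       r - r' ≡ deg D - genus G + + 1)
    × (∀ r → IsRank# G (K# G) r → r ≡ genus G - + 1)
    × deg (K# G) ≡ + 2 * genus G - + 2
    × (+ 2 * genus G - + 1 ≤ deg D → ∀ r → IsRank# G D r → r ≡ deg D - genus G)
theorem3p6 G@(graph zero [] []) conn nle D =
  (λ r r' rD _ → ⊥-elim (no-rank-on-empty {σ* G D} rD)) , (λ r rK → ⊥-elim (no-rank-on-empty {σ* G (K# G)} rK)) ,
  Subdivision.deg-K# 0 [] [] , (λ _ r rD → ⊥-elim (no-rank-on-empty {σ* G D} rD))
theorem3p6 (graph zero ((() , _) ∷ _) _) conn nle D
theorem3p6 (graph zero [] (() ∷ _)) conn nle D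
theorem3p6 (graph (suc k) es ls) conn nle D = part-RR , part-K , deg-K# , part-Riemann
  where
  open Subdivision (suc k) es ls
  Ê-loopless : All (λ e → proj₁ e ≢ proj₂ e) Ê
  Ê-loopless = Ĝ-loopless nle
  open Orientations Ê Ê-loopless using (K)
  deg-K̂ : deg K ≡ + 2 * genus G - + 2
  deg-K̂ = trans (∑-cong (K̂≡σ*K# Ê-loopless)) (trans (deg-σ* (K# G)) deg-K#)
  open RiemannRochLoopless Ê Ê-loopless (Ĝ-connected conn) (genus G) deg-K̂ Ĝ-edges-vertices zero
  σ*-K-D : ∀ x → σ* G (K# G ⊝ D) x ≡ (K ⊝ σ* G D) x
  σ*-K-D x = trans (σ*-⊝ (K# G) D x) (cong (_- σ* G D x) (sym (K̂≡σ*K# Ê-loopless x)))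
  part-RR : ∀ r r' → IsRank# G D r → IsRank# G (K# G ⊝ D) r' → r - r' ≡ deg D - genus G + + 1
  part-RR r r' rD rK-D = trans (riemann-roch (σ* G D) r r' rD (rank-cong {Ĝ} σ*-K-D rK-D))
                                     (cong (λ z → z - genus G + + 1) (deg-σ* D))
  part-K : ∀ r → IsRank# G (K# G) r → r ≡ genus G - + 1
  part-K r rK = rank-K r (rank-cong {Ĝ} (λ x → sym (K̂≡σ*K# Ê-loopless x)) rK)
  part-Riemann : + 2 * genus G - + 1 ≤ deg D → ∀ r → IsRank# G D r → r ≡ deg D - genus G
  part-Riemann big r rD = trans (riemann-large (σ* G D) (subst (+ 2 * genus G - + 1 ≤_) (sym (deg-σ* D)) big) r rD)
                            (cong (_- genus G) (deg-σ* D))
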